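{- Let $T$ be a fixed graph with $t$ vertices and $q$ edges, suppose $t$ divides $n$, and let $H$ be a $T$-factor in $K_n$. Then there is a uniform cover of width at most $qt$ of the pair $(K_n,H)$.
   Context: A $T$-factor in $K_n$ is a subgraph consisting of $n/t$ pairwise vertex-disjoint copies of $T$. For a graph $G$ and a subgraph $H$ of it, a uniform cover of width $s$ of the pair $(G,H)$ is a family $\mathcal H$ of graphs (possibly with repeated members) such that every member $H'$ of $\mathcal H$ is a subgraph of $G$ isomorphic to $H$, each such $H'$ has at most $s$ edges that are not edges of $H$, every edge of $H$ belongs to the same number of members of $\mathcal H$, and every edge in $E(G)\setminus E(H)$ belongs to the same positive number of members of $\mathcal H$. -}

module Defs where

open import Data.Nat using (ℕ; zero; suc; _+_; _*_; _≤_; _<ᵇ_)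
open import Data.Nat.Divisibility using (_∣_)
open import Data.Bool using (Bool; true; false; if_then_else_; _∧_; not)
open import Data.Fin using (Fin; toℕ)
open import Data.List using (List; []; _∷_; [_]; concatMap; allFin; map)
open import Data.Nat.ListAction using (sum)
open import Data.Product using (Σ; ∃; _×_; _,_; proj₁; proj₂)
open import Relation.Binary.PropositionalEquality using (_≡_)
open import Relation.Nullary using (¬_)
open import Function.Bundles using (_↔_; Inverse)

record Graph (n : ℕ) : Set where
  field
    adj   : Fin n → Fin n → Bool
    sym   : ∀ u v → adj u v ≡ adj v u
    irrefl : ∀ v → adj v v ≡ false
open Graph public

K : ∀ n → Fin n → Fin n → Bool
K n u v = not (toℕ u Data.Nat.≡ᵇ toℕ v)

pairs : ∀ n → List (Fin n × Fin n)
pairs n = concatMap (λ i → concatMap (λ j → if toℕ i <ᵇ toℕ j then [ (i , j) ] else []) (allFin n)) (allFin n)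

b2n : Bool → ℕ
b2n true = 1
b2n false = 0

countPairs : ∀ {n} → (Fin n → Fin n → Bool) → ℕ
countPairs {n} P = sum (map (λ p → b2n (P (proj₁ p) (proj₂ p))) (pairs n))

numEdges : ∀ {n} → Graph n → ℕ
numEdges G = countPairs (adj G)

_≅_ : ∀ {m n} → Graph m → Graph n → Set
_≅_ {m} {n} G H = Σ (Fin m ↔ Fin n) λ f → ∀ u v → adj H (Inverse.to f u) (Inverse.to f v) ≡ adj G u v

-- H is a T-factor of K_n: n/t (= m) pairwise vertex-disjoint copies of T whose union is H.
IsFactor : ∀ {t n} → Graph t → Graph n → Set
IsFactor {t} {n} T H =
  Σ ℕ λ m → (m * t ≡ n) × Σ (Fin m → Fin t → Fin n) λ φ →
    (∀ k l a b → φ k a ≡ φ l b → (k ≡ l) × (a ≡ b)) ×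
    (∀ k a b → adj H (φ k a) (φ k b) ≡ adj T a b) ×
    (∀ u v → adj H u v ≡ true → ∃ λ k → ∃ λ a → ∃ λ b → (u ≡ φ k a) × (v ≡ φ k b))

multiplicity : ∀ {n} → List (Graph n) → Fin n → Fin n → ℕ
multiplicity [] u v = 0
multiplicity (G ∷ Gs) u v = b2n (adj G u v) + multiplicity Gs u v

newEdges : ∀ {n} → Graph n → Graph n → ℕ
newEdges H H' = countPairs (λ u v → adj H' u v ∧ not (adj H u v))

data AllL {A : Set} (P : A → Set) : List A → Set where
  [] : AllL P []
  _∷_ : ∀ {x xs} → P x → AllL P xs → AllL P (x ∷ xs)

-- Uniform cover of width s of the pair (K_n, H).  Every graph on Fin n is a
-- subgraph of K_n; since H is spanning, a subgraph of K_n isomorphic to H is a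
-- graph on Fin n isomorphic to H.
UniformCoverKn : ∀ {n} → Graph n → ℕ → List (Graph n) → Set
UniformCoverKn {n} H s 𝓗 =
  AllL (λ H' → (H' ≅ H) × (newEdges H H' ≤ s)) 𝓗 ×
  (∃ λ c → ∀ u v → adj H u v ≡ true → multiplicity 𝓗 u v ≡ c) ×
  (∃ λ d → (1 ≤ d) × (∀ u v → K n u v ≡ true → adj H u v ≡ false → multiplicity 𝓗 u v ≡ d))

-- Write H as m vertex-disjoint copies of T, vertex φ k a being position a of copy k.
--
-- If m ≤ t, take H relabelled by every permutation of the vertices. This family is
-- invariant under all permutations, so every pair of distinct vertices has the same
-- multiplicity, and each member has at most |E(H)| = m q ≤ q t new edges.
--
-- If m ≥ t, mix two families. Shuffling the positions inside one copy covers pairs within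
-- a copy (edges C times, non-edges M times) and nothing across copies. Choosing t copies
-- and sending the a-th chosen copy to position a of every chosen copy (the transversal
-- move) covers each pair across copies X times, by symmetry in copies and in positions,
-- covers edges of unchosen copies, and no non-edge inside a copy. So X shuffle families
-- plus M transversal families give every non-edge multiplicity X M and every edge one
-- common multiplicity. A move that changes only the copies in a set S adds at most |S| q
-- new edges, so both kinds of members have width at most q t.

module Submission where

import Algebra.Properties.CommutativeMonoid.Sum as MonoidSum
import Algebra.Properties.CommutativeSemigroup as CommutativeSemigroupProperties
open import Data.Bool using (Bool; true; false; _∧_; not; if_then_else_)
open import Data.Bool.Properties using (∧-inverseʳ; ∧-zeroʳ; ∧-identityʳ)
open import Data.Empty using (⊥-elim)
open import Data.Fin using (Fin; zero; suc; toℕ; _↑ˡ_; _↑ʳ_; combine; remQuot; punchOut; inject≤)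
open import Data.Fin.Permutation
  using (Permutation; _⟨$⟩ʳ_; _⟨$⟩ˡ_; inverseˡ; inverseʳ; transpose; _∘ₚ_; permutation; flip)
open import Data.Fin.Properties
  using ( any?; all?; remQuot-combine; combine-remQuot; injective⇒≤; punchOut-injective; suc-injective
        ; toℕ-injective; inject≤-injective; nonZeroIndex )
  renaming (_≟_ to _≟ᶠ_)
open import Data.List using (List; []; _∷_; [_]; _++_; map; concatMap; allFin)
open import Data.List.Membership.Propositional using (_∈_)
open import Data.List.Membership.Propositional.Properties using (∈-allFin; ∈-map⁺; ∈-concatMap⁺)
open import Data.List.Properties using (map-tabulate)
open import Data.List.Relation.Unary.Any as Any using (here; there)
open import Data.Nat using (ℕ; zero; suc; _+_; _*_; _≤_; _≤?_; z≤n; _<ᵇ_; _≡ᵇ_)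
open import Data.Nat.Divisibility using (_∣_)
open import Data.Nat.ListAction using (sum)
open import Data.Nat.Properties
  using ( +-assoc; +-identityʳ; *-identityˡ; *-zeroʳ; *-distribˡ-+; *-comm; +-mono-≤; +-mono-<; *-monoˡ-≤; *-mono-≤
        ; ≤-refl; ≤-reflexive; ≤-trans; ≤-antisym; <-irrefl; <-asym; <⇒≤; <⇒≱; ≰⇒>; ≮⇒≥; m≤m+n; m≤n+m; m≤m*n
        ; <ᵇ-reflects-<; ≡⇒≡ᵇ; +-0-commutativeMonoid; +-commutativeSemigroup; module ≤-Reasoning )
open import Data.Product using (∃; _×_; _,_; proj₁; proj₂)
open import Data.Vec as Vec using (Vec; []; _∷_; lookup)
open import Data.Vec.Properties
  using (lookup-map; lookup∘tabulate; lookup∘updateAt; lookup∘updateAt′; lookup-replicate; lookup-allFin)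
open import Function using (_∘_; case_of_; _⟨_⟩_)
open import Function.Bundles using (mk⇔)
open import Function.Definitions using (Injective)
open import Relation.Binary.PropositionalEquality
  using (_≡_; _≢_; refl; sym; trans; cong; cong₂; subst; module ≡-Reasoning)
open import Relation.Nullary using (Dec; yes; no; does; ofʸ; ofⁿ)
open import Relation.Nullary.Decidable using (dec-true; dec-false; does-⇔; _→-dec_; map′)

open import Defs hiding (sym)

∑ : {A : Set} → List A → (A → ℕ) → ℕ
∑ xs f = sum (map f xs)

syntax ∑ xs (λ x → e) = ∑[ x ∈ xs ] e

private
  variable
    A B : Set

∑-cong : ∀ (xs : List A) {f g : A → ℕ} → (∀ x → f x ≡ g x) → ∑ xs f ≡ ∑ xs g
∑-cong []       f≗g = refl
∑-cong (x ∷ xs) f≗g = cong₂ _+_ (f≗g x) (∑-cong xs f≗g)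

∑-++ : ∀ (xs ys : List A) f → ∑ (xs ++ ys) f ≡ ∑ xs f + ∑ ys f
∑-++ []       ys f = refl
∑-++ (x ∷ xs) ys f = trans (cong (f x +_) (∑-++ xs ys f)) (sym (+-assoc (f x) _ _))

∑-zero : ∀ (xs : List A) → ∑[ x ∈ xs ] 0 ≡ 0
∑-zero []       = refl
∑-zero (x ∷ xs) = ∑-zero xs

∑-+ : ∀ (xs : List A) f g → ∑[ x ∈ xs ] (f x + g x) ≡ ∑ xs f + ∑ xs g
∑-+ []       f g = refl
∑-+ (x ∷ xs) f g = trans (cong (f x + g x +_) (∑-+ xs f g)) (+-interchange (f x) (g x) _ _)
  where open CommutativeSemigroupProperties +-commutativeSemigroup renaming (interchange to +-interchange)

∑-*ˡ : ∀ (xs : List A) c f → ∑[ x ∈ xs ] (c * f x) ≡ c * ∑ xs f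
∑-*ˡ []       c f = sym (*-zeroʳ c)
∑-*ˡ (x ∷ xs) c f = trans (cong (c * f x +_) (∑-*ˡ xs c f)) (sym (*-distribˡ-+ c (f x) _))

∑-mono-≤ : ∀ (xs : List A) {f g : A → ℕ} → (∀ x → f x ≤ g x) → ∑ xs f ≤ ∑ xs g
∑-mono-≤ []       f≤g = z≤n
∑-mono-≤ (x ∷ xs) f≤g = +-mono-≤ (f≤g x) (∑-mono-≤ xs f≤g)

∈⇒≤∑ : ∀ {xs : List A} {x} f → x ∈ xs → f x ≤ ∑ xs f
∈⇒≤∑ f (here refl) = m≤m+n _ _
∈⇒≤∑ {xs = y ∷ xs} f (there x∈xs) = ≤-trans (∈⇒≤∑ f x∈xs) (m≤n+m _ (f y))

∑-map : ∀ (xs : List A) (h : A → B) f → ∑ (map h xs) f ≡ ∑[ x ∈ xs ] f (h x)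
∑-map []       h f = refl
∑-map (x ∷ xs) h f = cong (f (h x) +_) (∑-map xs h f)

∑-concatMap : ∀ (xs : List A) (g : A → List B) f → ∑ (concatMap g xs) f ≡ ∑[ x ∈ xs ] ∑ (g x) f
∑-concatMap []       g f = refl
∑-concatMap (x ∷ xs) g f = trans (∑-++ (g x) (concatMap g xs) f) (cong (∑ (g x) f +_) (∑-concatMap xs g f))

∑-comm : ∀ (xs : List A) (ys : List B) (f : A → B → ℕ) →
  ∑[ x ∈ xs ] ∑[ y ∈ ys ] f x y ≡ ∑[ y ∈ ys ] ∑[ x ∈ xs ] f x y
∑-comm []       ys f = sym (∑-zero ys)
∑-comm (x ∷ xs) ys f = trans (cong (∑ ys (f x) +_) (∑-comm xs ys f)) (sym (∑-+ ys (f x) _))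

positive-count⇒witness : ∀ (xs : List A) (P : A → Bool) → 1 ≤ ∑[ x ∈ xs ] b2n (P x) → ∃ λ x → P x ≡ true
positive-count⇒witness (x ∷ xs) P positive with P x in Px
... | true  = x , Px
... | false = positive-count⇒witness xs P positive

∑-Invariant : List A → (A → A) → Set
∑-Invariant xs h = ∀ f → ∑[ x ∈ xs ] f (h x) ≡ ∑ xs f

∑-allFin-suc : ∀ N (f : Fin (suc N) → ℕ) → ∑ (allFin (suc N)) f ≡ f zero + ∑[ i ∈ allFin N ] f (suc i)
∑-allFin-suc N f = cong (λ xs → f zero + sum xs)
  (trans (map-tabulate suc f) (sym (map-tabulate (λ i → i) (f ∘ suc))))

∑-allFin-single : ∀ {N} (f : Fin N → ℕ) i → (∀ j → j ≢ i → f j ≡ 0) → ∑ (allFin N) f ≡ f i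
∑-allFin-single {suc N} f zero others = begin
  ∑ (allFin (suc N)) f
    ≡⟨ ∑-allFin-suc N f ⟩
  f zero + ∑[ j ∈ allFin N ] f (suc j)
    ≡⟨ cong (f zero +_) (trans (∑-cong (allFin N) (λ j → others (suc j) λ ())) (∑-zero (allFin N))) ⟩
  f zero + 0
    ≡⟨ +-identityʳ _ ⟩
  f zero ∎
  where open ≡-Reasoning
∑-allFin-single {suc N} f (suc i) others = begin
  ∑ (allFin (suc N)) f
    ≡⟨ ∑-allFin-suc N f ⟩
  f zero + ∑[ j ∈ allFin N ] f (suc j)
    ≡⟨ cong (_+ ∑[ j ∈ allFin N ] f (suc j)) (others zero λ ()) ⟩
  ∑[ j ∈ allFin N ] f (suc j)
    ≡⟨ ∑-allFin-single (f ∘ suc) i (λ j j≢i → others (suc j) (j≢i ∘ suc-injective)) ⟩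
  f (suc i) ∎
  where open ≡-Reasoning

∑-allFin-one : ∀ N → ∑[ _ ∈ allFin N ] 1 ≡ N
∑-allFin-one zero    = refl
∑-allFin-one (suc N) = trans (∑-allFin-suc N (λ _ → 1)) (cong suc (∑-allFin-one N))

∑-allFin-↑ : ∀ a b (f : Fin (a + b) → ℕ) →
  ∑ (allFin (a + b)) f ≡ ∑[ i ∈ allFin a ] f (i ↑ˡ b) + ∑[ j ∈ allFin b ] f (a ↑ʳ j)
∑-allFin-↑ zero    b f = refl
∑-allFin-↑ (suc a) b f = begin
  ∑ (allFin (suc a + b)) f
    ≡⟨ ∑-allFin-suc (a + b) f ⟩
  f zero + ∑[ i ∈ allFin (a + b) ] f (suc i)
    ≡⟨ cong (f zero +_) (∑-allFin-↑ a b (f ∘ suc)) ⟩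
  f zero + (∑[ i ∈ allFin a ] f (suc (i ↑ˡ b)) + ∑[ j ∈ allFin b ] f (suc a ↑ʳ j))
    ≡⟨ sym (+-assoc (f zero) _ _) ⟩
  f zero + ∑[ i ∈ allFin a ] f (suc (i ↑ˡ b)) + ∑[ j ∈ allFin b ] f (suc a ↑ʳ j)
    ≡⟨ cong (_+ ∑[ j ∈ allFin b ] f (suc a ↑ʳ j)) (sym (∑-allFin-suc a _)) ⟩
  ∑[ i ∈ allFin (suc a) ] f (i ↑ˡ b) + ∑[ j ∈ allFin b ] f (suc a ↑ʳ j) ∎
  where open ≡-Reasoning

∑-allFin-combine : ∀ m t (f : Fin (m * t) → ℕ) →
  ∑ (allFin (m * t)) f ≡ ∑[ k ∈ allFin m ] ∑[ a ∈ allFin t ] f (combine k a)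
∑-allFin-combine zero    t f = refl
∑-allFin-combine (suc m) t f = begin
  ∑ (allFin (t + m * t)) f
    ≡⟨ ∑-allFin-↑ t (m * t) f ⟩
  ∑[ a ∈ allFin t ] f (a ↑ˡ m * t) + ∑[ i ∈ allFin (m * t) ] f (t ↑ʳ i)
    ≡⟨ cong (∑[ a ∈ allFin t ] f (a ↑ˡ m * t) +_) (∑-allFin-combine m t (f ∘ (t ↑ʳ_))) ⟩
  ∑[ a ∈ allFin t ] f (a ↑ˡ m * t) + ∑[ k ∈ allFin m ] ∑[ a ∈ allFin t ] f (combine (suc k) a)
    ≡⟨ sym (∑-allFin-suc m _) ⟩
  ∑[ k ∈ allFin (suc m) ] ∑[ a ∈ allFin t ] f (combine k a) ∎
  where open ≡-Reasoning

∑-allFin-permute : ∀ {N} (π : Permutation N N) → ∑-Invariant (allFin N) (π ⟨$⟩ʳ_)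
∑-allFin-permute {N} π f = begin
  ∑[ i ∈ allFin N ] f (π ⟨$⟩ʳ i) ≡⟨ ∑-allFin≡sum (f ∘ (π ⟨$⟩ʳ_)) ⟩
  vsum (f ∘ (π ⟨$⟩ʳ_))           ≡⟨ sym (sum-permute f π) ⟩
  vsum f                         ≡⟨ sym (∑-allFin≡sum f) ⟩
  ∑ (allFin N) f                 ∎
  where
  open ≡-Reasoning
  open MonoidSum +-0-commutativeMonoid using (sum-permute) renaming (sum to vsum)
  ∑-allFin≡sum : ∀ {M} (g : Fin M → ℕ) → ∑ (allFin M) g ≡ vsum g
  ∑-allFin≡sum {zero}  g = refl
  ∑-allFin≡sum {suc M} g = trans (∑-allFin-suc M g) (cong (g zero +_) (∑-allFin≡sum (g ∘ suc)))

vectors : List A → ∀ k → List (Vec A k)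
vectors xs zero    = [ [] ]
vectors xs (suc k) = concatMap (λ x → map (x ∷_) (vectors xs k)) xs

∑-vectors-suc : ∀ (xs : List A) k f →
  ∑ (vectors xs (suc k)) f ≡ ∑[ x ∈ xs ] ∑[ v ∈ vectors xs k ] f (x ∷ v)
∑-vectors-suc xs k f = trans (∑-concatMap xs _ f) (∑-cong xs (λ x → ∑-map (vectors xs k) (x ∷_) f))

∈-vectors : ∀ {xs : List A} {k} (v : Vec A k) → (∀ i → lookup v i ∈ xs) → v ∈ vectors xs k
∈-vectors                   []      _       = here refl
∈-vectors {xs = xs} {suc k} (x ∷ v) entries =
  ∈-concatMap⁺ (λ y → map (y ∷_) (vectors xs k))
    (Any.map (λ { refl → ∈-map⁺ (x ∷_) (∈-vectors v (entries ∘ suc)) }) (entries zero))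

∑-vectors-map : ∀ {xs : List A} {h} → ∑-Invariant xs h → ∀ k → ∑-Invariant (vectors xs k) (Vec.map h)
∑-vectors-map         inv zero    f = refl
∑-vectors-map {xs = xs} {h} inv (suc k) f = begin
  ∑[ v ∈ vectors xs (suc k) ] f (Vec.map h v)
    ≡⟨ ∑-vectors-suc xs k _ ⟩
  ∑[ x ∈ xs ] ∑[ v ∈ vectors xs k ] f (h x ∷ Vec.map h v)
    ≡⟨ ∑-cong xs (λ x → ∑-vectors-map inv k (λ v → f (h x ∷ v))) ⟩
  ∑[ x ∈ xs ] ∑[ v ∈ vectors xs k ] f (h x ∷ v)
    ≡⟨ inv (λ y → ∑[ v ∈ vectors xs k ] f (y ∷ v)) ⟩
  ∑[ x ∈ xs ] ∑[ v ∈ vectors xs k ] f (x ∷ v)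
    ≡⟨ sym (∑-vectors-suc xs k f) ⟩
  ∑ (vectors xs (suc k)) f ∎
  where open ≡-Reasoning

∑-vectors-updateAt : ∀ {xs : List A} {h} → ∑-Invariant xs h → ∀ {k} (i : Fin k) →
  ∑-Invariant (vectors xs k) (λ v → Vec.updateAt v i h)
∑-vectors-updateAt {xs = xs} {h} inv {suc k} zero f = begin
  ∑[ v ∈ vectors xs (suc k) ] f (Vec.updateAt v zero h)
    ≡⟨ ∑-vectors-suc xs k _ ⟩
  ∑[ x ∈ xs ] ∑[ v ∈ vectors xs k ] f (h x ∷ v)
    ≡⟨ inv (λ y → ∑[ v ∈ vectors xs k ] f (y ∷ v)) ⟩
  ∑[ x ∈ xs ] ∑[ v ∈ vectors xs k ] f (x ∷ v)
    ≡⟨ sym (∑-vectors-suc xs k f) ⟩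
  ∑ (vectors xs (suc k)) f ∎
  where open ≡-Reasoning
∑-vectors-updateAt {xs = xs} {h} inv {suc k} (suc i) f = begin
  ∑[ v ∈ vectors xs (suc k) ] f (Vec.updateAt v (suc i) h)
    ≡⟨ ∑-vectors-suc xs k _ ⟩
  ∑[ x ∈ xs ] ∑[ v ∈ vectors xs k ] f (x ∷ Vec.updateAt v i h)
    ≡⟨ ∑-cong xs (λ x → ∑-vectors-updateAt inv i (λ v → f (x ∷ v))) ⟩
  ∑[ x ∈ xs ] ∑[ v ∈ vectors xs k ] f (x ∷ v)
    ≡⟨ sym (∑-vectors-suc xs k f) ⟩
  ∑ (vectors xs (suc k)) f ∎
  where open ≡-Reasoning

permutation-injective : ∀ {N} (π : Permutation N N) → Injective _≡_ _≡_ (π ⟨$⟩ʳ_)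
permutation-injective π {x} {y} πx≡πy = trans (sym (inverseˡ π)) (trans (cong (π ⟨$⟩ˡ_) πx≡πy) (inverseˡ π))

module _ {N : ℕ} where

  transpose-matchˡ : ∀ (i j : Fin N) → transpose i j ⟨$⟩ʳ i ≡ j
  transpose-matchˡ i j rewrite dec-true (i ≟ᶠ i) refl = refl

  transpose-matchʳ : ∀ (i j : Fin N) → transpose i j ⟨$⟩ʳ j ≡ i
  transpose-matchʳ i j with j ≟ᶠ i
  ... | yes j≡i = j≡i
  ... | no _ rewrite dec-true (j ≟ᶠ j) refl = refl

  transpose-other : ∀ {i j k : Fin N} → k ≢ i → k ≢ j → transpose i j ⟨$⟩ʳ k ≡ k
  transpose-other {i} {j} {k} k≢i k≢j rewrite dec-false (k ≟ᶠ i) k≢i | dec-false (k ≟ᶠ j) k≢j = refl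

  permutation-sending : ∀ {x y x′ y′ : Fin N} → x ≢ y → x′ ≢ y′ →
    ∃ λ (π : Permutation N N) → (π ⟨$⟩ʳ x ≡ x′) × (π ⟨$⟩ʳ y ≡ y′)
  permutation-sending {x} {y} {x′} {y′} x≢y x′≢y′ =
    transpose x x′ ∘ₚ transpose y₁ y′ , image-x , transpose-matchˡ y₁ y′
    where
    y₁ = transpose x x′ ⟨$⟩ʳ y
    x′≢y₁ : x′ ≢ y₁
    x′≢y₁ x′≡y₁ = x≢y (permutation-injective (transpose x x′) (trans (transpose-matchˡ x x′) x′≡y₁))
    image-x : transpose y₁ y′ ⟨$⟩ʳ (transpose x x′ ⟨$⟩ʳ x) ≡ x′
    image-x = trans (cong (transpose y₁ y′ ⟨$⟩ʳ_) (transpose-matchˡ x x′)) (transpose-other x′≢y₁ x′≢y′)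

∑-allFin-if≟ : ∀ {N} (c c′ : Fin N) (x y : ℕ) →
  ∑[ k ∈ allFin N ] (if does (k ≟ᶠ c) then x else y) ≡ ∑[ k ∈ allFin N ] (if does (k ≟ᶠ c′) then x else y)
∑-allFin-if≟ {N} c c′ x y = trans (sym (∑-allFin-permute (transpose c′ c) (λ k → pick k c))) (∑-cong (allFin N) moved)
  where
  pick : Fin N → Fin N → ℕ
  pick k d = if does (k ≟ᶠ d) then x else y
  pick-≡ : ∀ {k d} → k ≡ d → pick k d ≡ x
  pick-≡ {k} {d} k≡d = cong (if_then x else y) (dec-true (k ≟ᶠ d) k≡d)
  pick-≢ : ∀ {k d} → k ≢ d → pick k d ≡ y
  pick-≢ {k} {d} k≢d = cong (if_then x else y) (dec-false (k ≟ᶠ d) k≢d)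
  moved-by-cases : ∀ {k} → Dec (k ≡ c′) → Dec (k ≡ c) → pick (transpose c′ c ⟨$⟩ʳ k) c ≡ pick k c′
  moved-by-cases {k} (yes k≡c′) _ =
    trans (pick-≡ (trans (cong (transpose c′ c ⟨$⟩ʳ_) k≡c′) (transpose-matchˡ c′ c))) (sym (pick-≡ k≡c′))
  moved-by-cases {k} (no k≢c′) (yes k≡c) =
    trans (cong (λ z → pick z c) (trans (cong (transpose c′ c ⟨$⟩ʳ_) k≡c) (transpose-matchʳ c′ c)))
          (trans (pick-≢ (λ c′≡c → k≢c′ (trans k≡c (sym c′≡c)))) (sym (pick-≢ k≢c′)))
  moved-by-cases {k} (no k≢c′) (no k≢c) =
    trans (cong (λ z → pick z c) (transpose-other k≢c′ k≢c)) (trans (pick-≢ k≢c) (sym (pick-≢ k≢c′)))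
  moved : ∀ k → pick (transpose c′ c ⟨$⟩ʳ k) c ≡ pick k c′
  moved k = moved-by-cases (k ≟ᶠ c′) (k ≟ᶠ c)

-- Junk value: if y is not in the image of f, preimage f y = y.
preimage : ∀ {N} → (Fin N → Fin N) → Fin N → Fin N
preimage f y with any? (λ x → f x ≟ᶠ y)
... | yes (x , _) = x
... | no _        = y

injective⇒surjective : ∀ {N} {f : Fin N → Fin N} → Injective _≡_ _≡_ f → ∀ y → ∃ λ x → f x ≡ y
injective⇒surjective {suc N} {f} f-injective y with any? (λ x → f x ≟ᶠ y)
... | yes hit = hit
... | no miss = ⊥-elim (<-irrefl refl (injective⇒≤ punchOut∘f-injective))
  where
  y≢f : ∀ x → y ≢ f x
  y≢f x y≡fx = miss (x , sym y≡fx)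
  punchOut∘f-injective : Injective _≡_ _≡_ (λ x → punchOut (y≢f x))
  punchOut∘f-injective e = f-injective (punchOut-injective (y≢f _) (y≢f _) e)

module _ {N} {f : Fin N → Fin N} (f-injective : Injective _≡_ _≡_ f) where

  f∘preimage : ∀ y → f (preimage f y) ≡ y
  f∘preimage y with any? (λ x → f x ≟ᶠ y)
  ... | yes (_ , fx≡y) = fx≡y
  ... | no miss        = ⊥-elim (miss (injective⇒surjective f-injective y))

  preimage∘f : ∀ x → preimage f (f x) ≡ x
  preimage∘f x = f-injective (f∘preimage (f x))

  preimage-unique : ∀ {x y} → f x ≡ y → preimage f y ≡ x
  preimage-unique {x} refl = preimage∘f x

does≡true⇒ : ∀ {P : Set} (P? : Dec P) → does P? ≡ true → P
does≡true⇒ (yes p) _ = p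

∧-cong-if : ∀ {a a′ b b′} → a ≡ a′ → (a′ ≡ true → b ≡ b′) → a ∧ b ≡ a′ ∧ b′
∧-cong-if {a′ = true}  refl b≡b′ = b≡b′ refl
∧-cong-if {a′ = false} refl b≡b′ = refl

b2n-∧-≤ˡ : ∀ a b → b2n (a ∧ b) ≤ b2n a
b2n-∧-≤ˡ true  true  = ≤-refl
b2n-∧-≤ˡ true  false = z≤n
b2n-∧-≤ˡ false b     = z≤n

m+m≤n+n⇒m≤n : ∀ {a b} → a + a ≤ b + b → a ≤ b
m+m≤n+n⇒m≤n {a} {b} a+a≤b+b with a ≤? b
... | yes a≤b = a≤b
... | no  a≰b = ⊥-elim (<⇒≱ (+-mono-< (≰⇒> a≰b) (≰⇒> a≰b)) a+a≤b+b)

∧-true⁻ˡ : ∀ {a b} → a ∧ b ≡ true → a ≡ true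
∧-true⁻ˡ {true} _ = refl

∧-true⁻ʳ : ∀ {a b} → a ∧ b ≡ true → b ≡ true
∧-true⁻ʳ {true} a∧b = a∧b

module _ {N M : ℕ} where

  injective? : (v : Vec (Fin M) N) → Dec (Injective _≡_ _≡_ (lookup v))
  injective? v = map′ (λ inj → inj _ _) (λ inj _ _ → inj)
    (all? λ i → all? λ j → (lookup v i ≟ᶠ lookup v j) →-dec (i ≟ᶠ j))

  isInjective : Vec (Fin M) N → Bool
  isInjective v = does (injective? v)

  isInjective⇒injective : ∀ v → isInjective v ≡ true → Injective _≡_ _≡_ (lookup v)
  isInjective⇒injective v = does≡true⇒ (injective? v)

  isInjective-map : ∀ (π : Permutation M M) v → isInjective (Vec.map (π ⟨$⟩ʳ_) v) ≡ isInjective v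
  isInjective-map π v = does-⇔ (mk⇔ forget remember) (injective? (Vec.map (π ⟨$⟩ʳ_) v)) (injective? v)
    where
    forget : Injective _≡_ _≡_ (lookup (Vec.map (π ⟨$⟩ʳ_) v)) → Injective _≡_ _≡_ (lookup v)
    forget inj {i} {j} e = inj (trans (lookup-map i _ v) (trans (cong (π ⟨$⟩ʳ_) e) (sym (lookup-map j _ v))))
    remember : Injective _≡_ _≡_ (lookup v) → Injective _≡_ _≡_ (lookup (Vec.map (π ⟨$⟩ʳ_) v))
    remember inj {i} {j} e = inj (permutation-injective π (trans (sym (lookup-map i _ v)) (trans e (lookup-map j _ v))))

allInjective : ∀ {t k} → Vec (Vec (Fin t) t) k → Bool
allInjective []      = true
allInjective (v ∷ σ) = isInjective v ∧ allInjective σ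

allInjective-lookup : ∀ {t k} (σ : Vec (Vec (Fin t) t) k) → allInjective σ ≡ true → ∀ a → isInjective (lookup σ a) ≡ true
allInjective-lookup (v ∷ σ) inj zero    = ∧-true⁻ˡ inj
allInjective-lookup (v ∷ σ) inj (suc a) = allInjective-lookup σ (∧-true⁻ʳ {isInjective v} inj) a

allInjective-updateAt : ∀ {t k} (π : Permutation t t) (σ : Vec (Vec (Fin t) t) k) a →
  allInjective (Vec.updateAt σ a (Vec.map (π ⟨$⟩ʳ_))) ≡ allInjective σ
allInjective-updateAt π (v ∷ σ) zero    = cong (_∧ allInjective σ) (isInjective-map π v)
allInjective-updateAt π (v ∷ σ) (suc a) = cong (isInjective v ∧_) (allInjective-updateAt π σ a)

allInjective-replicate : ∀ {t} k {v : Vec (Fin t) t} → isInjective v ≡ true → allInjective (Vec.replicate k v) ≡ true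
allInjective-replicate zero    inj = refl
allInjective-replicate (suc k) inj rewrite inj = allInjective-replicate k inj

endomaps : ∀ N → List (Vec (Fin N) N)
endomaps N = vectors (allFin N) N

module _ {N : ℕ} where

  ∈-endomaps : ∀ v → v ∈ endomaps N
  ∈-endomaps v = ∈-vectors v (λ i → ∈-allFin (lookup v i))

  _⁻¹ : Vec (Fin N) N → Fin N → Fin N
  v ⁻¹ = preimage (lookup v)

  module _ (v : Vec (Fin N) N) (inj : isInjective v ≡ true) where

    lookup∘⁻¹ : ∀ x → lookup v ((v ⁻¹) x) ≡ x
    lookup∘⁻¹ = f∘preimage (isInjective⇒injective v inj)

    ⁻¹∘lookup : ∀ i → (v ⁻¹) (lookup v i) ≡ i
    ⁻¹∘lookup = preimage∘f (isInjective⇒injective v inj)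

    ⁻¹-permutation : Permutation N N
    ⁻¹-permutation = permutation (v ⁻¹) (lookup v) ⁻¹∘lookup lookup∘⁻¹

    ⁻¹-map : ∀ (π : Permutation N N) x → (Vec.map (π ⟨$⟩ʳ_) v ⁻¹) (π ⟨$⟩ʳ x) ≡ (v ⁻¹) x
    ⁻¹-map π x = preimage-unique (isInjective⇒injective (Vec.map (π ⟨$⟩ʳ_) v) (trans (isInjective-map π v) inj))
      (trans (lookup-map _ _ v) (cong (π ⟨$⟩ʳ_) (lookup∘⁻¹ x)))

  isInjective-allFin : isInjective (Vec.allFin N) ≡ true
  isInjective-allFin = dec-true (injective? (Vec.allFin N)) (λ {i} {j} e → trans (sym (lookup-allFin i)) (trans e (lookup-allFin j)))

  allFin⁻¹ : ∀ x → (Vec.allFin N ⁻¹) x ≡ x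
  allFin⁻¹ x = preimage-unique (isInjective⇒injective (Vec.allFin N) isInjective-allFin) (lookup-allFin x)

  relabel : (Fin N → Fin N) → Graph N → Graph N
  relabel f G = record
    { adj    = λ u w → adj G (f u) (f w)
    ; sym    = λ u w → Graph.sym G (f u) (f w)
    ; irrefl = λ u → irrefl G (f u)
    }

  relabel-≅ : ∀ (π : Permutation N N) G → relabel (π ⟨$⟩ʳ_) G ≅ G
  relabel-≅ π G = π , λ _ _ → refl

  symCount : (Fin N → Fin N → Bool) → Fin N → Fin N → ℕ
  symCount g x y = ∑[ v ∈ endomaps N ] b2n (isInjective v ∧ g ((v ⁻¹) x) ((v ⁻¹) y))

  symCount-permute : ∀ g (π : Permutation N N) x y → symCount g (π ⟨$⟩ʳ x) (π ⟨$⟩ʳ y) ≡ symCount g x y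
  symCount-permute g π x y = begin
    symCount g (π ⟨$⟩ʳ x) (π ⟨$⟩ʳ y)
      ≡⟨ sym (∑-vectors-map (∑-allFin-permute π) N _) ⟩
    ∑[ v ∈ endomaps N ] term (Vec.map (π ⟨$⟩ʳ_) v)
      ≡⟨ ∑-cong (endomaps N) term-map ⟩
    symCount g x y ∎
    where
    open ≡-Reasoning
    term : Vec (Fin N) N → ℕ
    term v = b2n (isInjective v ∧ g ((v ⁻¹) (π ⟨$⟩ʳ x)) ((v ⁻¹) (π ⟨$⟩ʳ y)))
    term-map : ∀ v → term (Vec.map (π ⟨$⟩ʳ_) v) ≡ b2n (isInjective v ∧ g ((v ⁻¹) x) ((v ⁻¹) y))
    term-map v = cong b2n (∧-cong-if (isInjective-map π v) (λ inj → cong₂ g (⁻¹-map v inj π x) (⁻¹-map v inj π y)))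

  symCount-const : ∀ g {x y x′ y′} → x ≢ y → x′ ≢ y′ → symCount g x y ≡ symCount g x′ y′
  symCount-const g x≢y x′≢y′ with permutation-sending x≢y x′≢y′
  ... | π , πx≡x′ , πy≡y′ = trans (sym (symCount-permute g π _ _)) (cong₂ (symCount g) πx≡x′ πy≡y′)

  symCount-≥ : ∀ g x y → b2n (g x y) ≤ symCount g x y
  symCount-≥ g x y = subst (_≤ symCount g x y) identity-term (∈⇒≤∑ _ (∈-endomaps (Vec.allFin N)))
    where
    identity-term : b2n (isInjective (Vec.allFin N) ∧ g ((Vec.allFin N ⁻¹) x) ((Vec.allFin N ⁻¹) y)) ≡ b2n (g x y)
    identity-term rewrite isInjective-allFin | allFin⁻¹ x | allFin⁻¹ y = refl

edge-≢ : ∀ {N} (G : Graph N) {u w} → adj G u w ≡ true → u ≢ w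
edge-≢ G {u} Guw refl with () ← trans (sym Guw) (irrefl G u)

K-≢ : ∀ {N} {u w : Fin N} → K N u w ≡ true → u ≢ w
K-≢ {u = u} Kuw refl with toℕ u ≡ᵇ toℕ u | ≡⇒≡ᵇ (toℕ u) (toℕ u) refl
K-≢ {u = u} () refl | true | _

countOrdered : ∀ {N} → (Fin N → Fin N → Bool) → ℕ
countOrdered {N} P = ∑[ i ∈ allFin N ] ∑[ j ∈ allFin N ] b2n (P i j)

module _ {N} (P : Fin N → Fin N → Bool) where

  private
    _≺_ : Fin N → Fin N → ℕ
    i ≺ j = b2n (toℕ i <ᵇ toℕ j)

  countPairs≡∑∑ : countPairs P ≡ ∑[ i ∈ allFin N ] ∑[ j ∈ allFin N ] ((i ≺ j) * b2n (P i j))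
  countPairs≡∑∑ = begin
    ∑ (pairs N) Pᵘ
      ≡⟨ ∑-concatMap (allFin N) _ Pᵘ ⟩
    ∑[ i ∈ allFin N ] ∑ (concatMap (λ j → if toℕ i <ᵇ toℕ j then [ (i , j) ] else []) (allFin N)) Pᵘ
      ≡⟨ ∑-cong (allFin N) (λ i → ∑-concatMap (allFin N) _ Pᵘ) ⟩
    ∑[ i ∈ allFin N ] ∑[ j ∈ allFin N ] ∑ (if toℕ i <ᵇ toℕ j then [ (i , j) ] else []) Pᵘ
      ≡⟨ ∑-cong (allFin N) (λ i → ∑-cong (allFin N) (λ j → singleton-if (toℕ i <ᵇ toℕ j))) ⟩
    ∑[ i ∈ allFin N ] ∑[ j ∈ allFin N ] ((i ≺ j) * b2n (P i j)) ∎
    where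
    open ≡-Reasoning
    Pᵘ : Fin N × Fin N → ℕ
    Pᵘ (i , j) = b2n (P i j)
    singleton-if : ∀ {i j} b → ∑ (if b then [ (i , j) ] else []) Pᵘ ≡ b2n b * b2n (P i j)
    singleton-if true  = refl
    singleton-if false = refl

  module _ (P-sym : ∀ i j → P i j ≡ P j i) (P-irrefl : ∀ i → P i i ≡ false) where

    split-by-order : ∀ i j → b2n (P i j) ≡ (i ≺ j) * b2n (P i j) + (j ≺ i) * b2n (P i j)
    split-by-order i j with toℕ i <ᵇ toℕ j | <ᵇ-reflects-< (toℕ i) (toℕ j)
                          | toℕ j <ᵇ toℕ i | <ᵇ-reflects-< (toℕ j) (toℕ i)
    ... | true  | ofʸ i<j | true  | ofʸ j<i = ⊥-elim (<-asym i<j j<i)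
    ... | true  | _       | false | _       = sym (trans (+-identityʳ _) (*-identityˡ _))
    ... | false | _       | true  | _       = sym (*-identityˡ _)
    ... | false | ofⁿ i≮j | false | ofⁿ j≮i
      rewrite toℕ-injective (≤-antisym (≮⇒≥ j≮i) (≮⇒≥ i≮j)) | P-irrefl j = refl

    countOrdered≡countPairs+countPairs : countOrdered P ≡ countPairs P + countPairs P
    countOrdered≡countPairs+countPairs = begin
      countOrdered P
        ≡⟨ ∑-cong (allFin N) (λ i → ∑-cong (allFin N) (split-by-order i)) ⟩
      ∑[ i ∈ allFin N ] ∑[ j ∈ allFin N ] (lower i j + upper i j)
        ≡⟨ ∑-cong (allFin N) (λ i → ∑-+ (allFin N) (lower i) (upper i)) ⟩
      ∑[ i ∈ allFin N ] (∑ (allFin N) (lower i) + ∑ (allFin N) (upper i))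
        ≡⟨ ∑-+ (allFin N) _ _ ⟩
      ∑∑ lower + ∑∑ upper
        ≡⟨ cong (∑∑ lower +_) upper≡lower ⟩
      ∑∑ lower + ∑∑ lower
        ≡⟨ sym (cong₂ _+_ countPairs≡∑∑ countPairs≡∑∑) ⟩
      countPairs P + countPairs P ∎
      where
      open ≡-Reasoning
      lower upper : Fin N → Fin N → ℕ
      lower i j = (i ≺ j) * b2n (P i j)
      upper i j = (j ≺ i) * b2n (P i j)
      ∑∑ : (Fin N → Fin N → ℕ) → ℕ
      ∑∑ f = ∑[ i ∈ allFin N ] ∑ (allFin N) (f i)
      upper≡lower : ∑∑ upper ≡ ∑∑ lower
      upper≡lower = trans (∑-comm (allFin N) (allFin N) upper)
        (∑-cong (allFin N) (λ j → ∑-cong (allFin N) (λ i → cong (λ b → (j ≺ i) * b2n b) (P-sym i j))))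

module _ {n : ℕ} where

  select : {I : Set} → (I → Bool) → (I → Graph n) → List I → List (Graph n)
  select valid graph = concatMap (λ i → if valid i then [ graph i ] else [])

  repeat : ℕ → List (Graph n) → List (Graph n)
  repeat zero    Gs = []
  repeat (suc r) Gs = Gs ++ repeat r Gs

  multiplicity-++ : ∀ (Gs Hs : List (Graph n)) u w →
    multiplicity (Gs ++ Hs) u w ≡ multiplicity Gs u w + multiplicity Hs u w
  multiplicity-++ []       Hs u w = refl
  multiplicity-++ (G ∷ Gs) Hs u w = trans (cong (b2n (adj G u w) +_) (multiplicity-++ Gs Hs u w)) (sym (+-assoc (b2n (adj G u w)) _ _))

  multiplicity-concatMap : ∀ {I : Set} (g : I → List (Graph n)) is u w →
    multiplicity (concatMap g is) u w ≡ ∑[ i ∈ is ] multiplicity (g i) u w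
  multiplicity-concatMap g []       u w = refl
  multiplicity-concatMap g (i ∷ is) u w =
    trans (multiplicity-++ (g i) _ u w) (cong (multiplicity (g i) u w +_) (multiplicity-concatMap g is u w))

  multiplicity-select : ∀ {I : Set} valid (graph : I → Graph n) is u w →
    multiplicity (select valid graph is) u w ≡ ∑[ i ∈ is ] b2n (valid i ∧ adj (graph i) u w)
  multiplicity-select valid graph is u w = trans (multiplicity-concatMap _ is u w) (∑-cong is singleton-if)
    where
    singleton-if : ∀ i → multiplicity (if valid i then [ graph i ] else []) u w ≡ b2n (valid i ∧ adj (graph i) u w)
    singleton-if i with valid i
    ... | true  = +-identityʳ _
    ... | false = refl

  multiplicity-repeat : ∀ r Gs u w → multiplicity (repeat r Gs) u w ≡ r * multiplicity Gs u w
  multiplicity-repeat zero    Gs u w = refl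
  multiplicity-repeat (suc r) Gs u w = trans (multiplicity-++ Gs (repeat r Gs) u w) (cong (multiplicity Gs u w +_) (multiplicity-repeat r Gs u w))

  module _ {P : Graph n → Set} where

    AllL-++ : ∀ {Gs Hs} → AllL P Gs → AllL P Hs → AllL P (Gs ++ Hs)
    AllL-++ []         pHs = pHs
    AllL-++ (pG ∷ pGs) pHs = pG ∷ AllL-++ pGs pHs

    AllL-concatMap : ∀ {I : Set} (g : I → List (Graph n)) is → (∀ i → AllL P (g i)) → AllL P (concatMap g is)
    AllL-concatMap g []       pg = []
    AllL-concatMap g (i ∷ is) pg = AllL-++ (pg i) (AllL-concatMap g is pg)

    AllL-select : ∀ {I : Set} valid (graph : I → Graph n) is → (∀ i → valid i ≡ true → P (graph i)) →
      AllL P (select valid graph is)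
    AllL-select valid graph is p = AllL-concatMap _ is singleton-if
      where
      singleton-if : ∀ i → AllL P (if valid i then [ graph i ] else [])
      singleton-if i with valid i in valid-i
      ... | true  = p i valid-i ∷ []
      ... | false = []

    AllL-repeat : ∀ r {Gs} → AllL P Gs → AllL P (repeat r Gs)
    AllL-repeat zero    pGs = []
    AllL-repeat (suc r) pGs = AllL-++ pGs (AllL-repeat r pGs)

relabellings : ∀ {N} → Graph N → List (Graph N)
relabellings {N} G = select isInjective (λ v → relabel (v ⁻¹) G) (endomaps N)

multiplicity-relabellings : ∀ {N} (G : Graph N) u w → multiplicity (relabellings G) u w ≡ symCount (adj G) u w
multiplicity-relabellings {N} G = multiplicity-select isInjective (λ v → relabel (v ⁻¹) G) (endomaps N)

module Factor {t m : ℕ} (T : Graph t) (H : Graph (m * t)) (φ : Fin m → Fin t → Fin (m * t))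
  (φ-injective : ∀ k l a b → φ k a ≡ φ l b → (k ≡ l) × (a ≡ b))
  (φ-adj : ∀ k a b → adj H (φ k a) (φ k b) ≡ adj T a b)
  (φ-cover : ∀ u v → adj H u v ≡ true → ∃ λ k → ∃ λ a → ∃ λ b → (u ≡ φ k a) × (v ≡ φ k b)) where

  n : ℕ
  n = m * t

  private
    φ∘remQuot : Fin n → Fin n
    φ∘remQuot i = let (k , a) = remQuot {m} t i in φ k a

    φ∘remQuot-injective : Injective _≡_ _≡_ φ∘remQuot
    φ∘remQuot-injective {i} {j} e with φ-injective _ _ _ _ e
    ... | k≡l , a≡b = trans (sym (combine-remQuot {m} t i)) (trans (cong₂ combine k≡l a≡b) (combine-remQuot {m} t j))

    φ∘remQuot-permutation : Permutation n n
    φ∘remQuot-permutation = permutation φ∘remQuot (preimage φ∘remQuot)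
      (f∘preimage φ∘remQuot-injective) (preimage∘f φ∘remQuot-injective)

  copy : Fin n → Fin m
  copy u = proj₁ (remQuot {m} t (preimage φ∘remQuot u))

  pos : Fin n → Fin t
  pos u = proj₂ (remQuot {m} t (preimage φ∘remQuot u))

  φ-copy-pos : ∀ u → φ (copy u) (pos u) ≡ u
  φ-copy-pos = f∘preimage φ∘remQuot-injective

  copy-φ : ∀ k a → copy (φ k a) ≡ k
  copy-φ k a = proj₁ (φ-injective _ _ _ _ (φ-copy-pos (φ k a)))

  pos-φ : ∀ k a → pos (φ k a) ≡ a
  pos-φ k a = proj₂ (φ-injective _ _ _ _ (φ-copy-pos (φ k a)))

  adj-across : ∀ {u w} → copy u ≢ copy w → adj H u w ≡ false
  adj-across {u} {w} copy-u≢copy-w with adj H u w in Huw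
  ... | false = refl
  ... | true with φ-cover u w Huw
  ... | k , a , b , refl , refl = ⊥-elim (copy-u≢copy-w (trans (copy-φ k a) (sym (copy-φ k b))))

  adj⇒same-copy : ∀ {u w} → adj H u w ≡ true → copy u ≡ copy w
  adj⇒same-copy {u} {w} Huw with copy u ≟ᶠ copy w
  ... | yes same = same
  ... | no  diff with () ← trans (sym Huw) (adj-across diff)

  adj-within : ∀ {u w} → copy u ≡ copy w → adj H u w ≡ adj T (pos u) (pos w)
  adj-within {u} {w} same = begin
    adj H u w
      ≡⟨ sym (cong₂ (adj H) (φ-copy-pos u) (φ-copy-pos w)) ⟩
    adj H (φ (copy u) (pos u)) (φ (copy w) (pos w))
      ≡⟨ cong (λ k → adj H (φ (copy u) (pos u)) (φ k (pos w))) (sym same) ⟩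
    adj H (φ (copy u) (pos u)) (φ (copy u) (pos w))
      ≡⟨ φ-adj _ _ _ ⟩
    adj T (pos u) (pos w) ∎
    where open ≡-Reasoning

  ∑-vertices : ∀ f → ∑ (allFin n) f ≡ ∑[ k ∈ allFin m ] ∑[ a ∈ allFin t ] f (φ k a)
  ∑-vertices f = begin
    ∑ (allFin n) f
      ≡⟨ sym (∑-allFin-permute φ∘remQuot-permutation f) ⟩
    ∑[ i ∈ allFin n ] f (φ∘remQuot i)
      ≡⟨ ∑-allFin-combine m t _ ⟩
    ∑[ k ∈ allFin m ] ∑[ a ∈ allFin t ] f (φ∘remQuot (combine k a))
      ≡⟨ ∑-cong (allFin m) (λ k → ∑-cong (allFin t) (λ a → cong (λ (l , b) → f (φ l b)) (remQuot-combine k a))) ⟩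
    ∑[ k ∈ allFin m ] ∑[ a ∈ allFin t ] f (φ k a) ∎
    where open ≡-Reasoning

  degree : Fin n → ℕ
  degree u = ∑[ w ∈ allFin n ] b2n (adj H u w)

  degree-φ : ∀ k a → degree (φ k a) ≡ ∑[ b ∈ allFin t ] b2n (adj T a b)
  degree-φ k a = begin
    degree (φ k a)
      ≡⟨ ∑-vertices _ ⟩
    ∑[ l ∈ allFin m ] ∑[ b ∈ allFin t ] b2n (adj H (φ k a) (φ l b))
      ≡⟨ ∑-allFin-single _ k other-copies ⟩
    ∑[ b ∈ allFin t ] b2n (adj H (φ k a) (φ k b))
      ≡⟨ ∑-cong (allFin t) (λ b → cong b2n (φ-adj k a b)) ⟩
    ∑[ b ∈ allFin t ] b2n (adj T a b) ∎
    where
    open ≡-Reasoning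
    other-copies : ∀ l → l ≢ k → ∑[ b ∈ allFin t ] b2n (adj H (φ k a) (φ l b)) ≡ 0
    other-copies l l≢k = trans
      (∑-cong (allFin t) (λ b → cong b2n (adj-across (λ e → l≢k (trans (sym (copy-φ l b)) (trans (sym e) (copy-φ k a)))))))
      (∑-zero (allFin t))

  count : (Fin m → Bool) → ℕ
  count S = ∑[ k ∈ allFin m ] b2n (S k)

  ∑-degree-on : ∀ S → ∑[ u ∈ allFin n ] (b2n (S (copy u)) * degree u) ≡ count S * countOrdered (adj T)
  ∑-degree-on S = begin
    ∑[ u ∈ allFin n ] (b2n (S (copy u)) * degree u)
      ≡⟨ ∑-vertices _ ⟩
    ∑[ k ∈ allFin m ] ∑[ a ∈ allFin t ] (b2n (S (copy (φ k a))) * degree (φ k a))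
      ≡⟨ ∑-cong (allFin m) (λ k → ∑-cong (allFin t) (λ a →
          cong₂ (λ l d → b2n (S l) * d) (copy-φ k a) (degree-φ k a))) ⟩
    ∑[ k ∈ allFin m ] ∑[ a ∈ allFin t ] (b2n (S k) * degreeᵀ a)
      ≡⟨ ∑-cong (allFin m) (λ k → ∑-*ˡ (allFin t) (b2n (S k)) degreeᵀ) ⟩
    ∑[ k ∈ allFin m ] (b2n (S k) * countOrdered (adj T))
      ≡⟨ ∑-cong (allFin m) (λ k → *-comm (b2n (S k)) _) ⟩
    ∑[ k ∈ allFin m ] (countOrdered (adj T) * b2n (S k))
      ≡⟨ ∑-*ˡ (allFin m) (countOrdered (adj T)) (b2n ∘ S) ⟩
    countOrdered (adj T) * count S
      ≡⟨ *-comm _ (count S) ⟩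
    count S * countOrdered (adj T) ∎
    where
    open ≡-Reasoning
    degreeᵀ : Fin t → ℕ
    degreeᵀ a = ∑[ b ∈ allFin t ] b2n (adj T a b)

  -- Double counting: a new edge u w of H ∘ f is an edge at f u inside an S-copy.
  module _ (f : Permutation n n) (S : Fin m → Bool)
           (fixes : ∀ u → S (copy u) ≡ false → f ⟨$⟩ʳ u ≡ u)
           (S-invariant : ∀ u → S (copy (f ⟨$⟩ʳ u)) ≡ S (copy u)) where

    private
      new : Fin n → Fin n → Bool
      new u w = adj H (f ⟨$⟩ʳ u) (f ⟨$⟩ʳ w) ∧ not (adj H u w)

      new-outside : ∀ u w → S (copy u) ≡ false → new u w ≡ false
      new-outside u w Su rewrite fixes u Su with S (copy w) in Sw
      ... | false rewrite fixes w Sw = ∧-inverseʳ (adj H u w)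
      ... | true  rewrite adj-across {u} {f ⟨$⟩ʳ w} (λ e → case trans (trans (sym Su) (cong S e)) (trans (S-invariant w) Sw) of λ ())
                  = refl

      row-≤ : ∀ u → ∑[ w ∈ allFin n ] b2n (new u w) ≤ b2n (S (copy u)) * degree (f ⟨$⟩ʳ u)
      row-≤ u with S (copy u) in Su
      ... | true = begin
        ∑[ w ∈ allFin n ] b2n (new u w)
          ≤⟨ ∑-mono-≤ (allFin n) (λ w → b2n-∧-≤ˡ (adj H (f ⟨$⟩ʳ u) (f ⟨$⟩ʳ w)) _) ⟩
        ∑[ w ∈ allFin n ] b2n (adj H (f ⟨$⟩ʳ u) (f ⟨$⟩ʳ w))
          ≡⟨ ∑-allFin-permute f (λ w → b2n (adj H (f ⟨$⟩ʳ u) w)) ⟩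
        degree (f ⟨$⟩ʳ u)
          ≡⟨ sym (*-identityˡ _) ⟩
        1 * degree (f ⟨$⟩ʳ u) ∎
        where open ≤-Reasoning
      ... | false = ≤-reflexive (trans (∑-cong (allFin n) (λ w → cong b2n (new-outside u w Su))) (∑-zero (allFin n)))

      reindex : ∑[ u ∈ allFin n ] (b2n (S (copy u)) * degree (f ⟨$⟩ʳ u)) ≡ ∑[ u ∈ allFin n ] (b2n (S (copy u)) * degree u)
      reindex = trans (sym (∑-allFin-permute (flip f) _)) (∑-cong (allFin n) λ u →
        cong₂ (λ s v → b2n s * degree v) (trans (sym (S-invariant (f ⟨$⟩ˡ u))) (cong (S ∘ copy) (inverseʳ f))) (inverseʳ f))

      countOrdered-new : countOrdered new ≤ count S * countOrdered (adj T)
      countOrdered-new = begin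
        countOrdered new                                         ≤⟨ ∑-mono-≤ (allFin n) row-≤ ⟩
        ∑[ u ∈ allFin n ] (b2n (S (copy u)) * degree (f ⟨$⟩ʳ u)) ≡⟨ reindex ⟩
        ∑[ u ∈ allFin n ] (b2n (S (copy u)) * degree u)          ≡⟨ ∑-degree-on S ⟩
        count S * countOrdered (adj T)                           ∎
        where open ≤-Reasoning

    newEdges-relabel-≤ : newEdges H (relabel (f ⟨$⟩ʳ_) H) ≤ count S * numEdges T
    newEdges-relabel-≤ = m+m≤n+n⇒m≤n (begin
      newEdges H (relabel (f ⟨$⟩ʳ_) H) + newEdges H (relabel (f ⟨$⟩ʳ_) H)
        ≡⟨ sym (countOrdered≡countPairs+countPairs new new-sym new-irrefl) ⟩
      countOrdered new
        ≤⟨ countOrdered-new ⟩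
      count S * countOrdered (adj T)
        ≡⟨ cong (count S *_) (countOrdered≡countPairs+countPairs (adj T) (Graph.sym T) (irrefl T)) ⟩
      count S * (numEdges T + numEdges T)
        ≡⟨ *-distribˡ-+ (count S) _ _ ⟩
      count S * numEdges T + count S * numEdges T ∎)
      where
      open ≤-Reasoning
      new-sym : ∀ u w → new u w ≡ new w u
      new-sym u w = cong₂ (λ x y → x ∧ not y) (Graph.sym H _ _) (Graph.sym H u w)
      new-irrefl : ∀ u → new u u ≡ false
      new-irrefl u = cong (_∧ not (adj H u u)) (irrefl H (f ⟨$⟩ʳ u))

  reshuffle : Fin m → (Fin t → Fin t) → Fin n → Fin n
  reshuffle k π u with copy u ≟ᶠ k
  ... | yes _ = φ k (π (pos u))
  ... | no  _ = u

  reshuffle-inside : ∀ {k} π {u} → copy u ≡ k → reshuffle k π u ≡ φ k (π (pos u))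
  reshuffle-inside {k} π {u} inside with copy u ≟ᶠ k
  ... | yes _       = refl
  ... | no  outside = ⊥-elim (outside inside)

  reshuffle-outside : ∀ {k} π {u} → copy u ≢ k → reshuffle k π u ≡ u
  reshuffle-outside {k} π {u} outside with copy u ≟ᶠ k
  ... | yes inside = ⊥-elim (outside inside)
  ... | no  _      = refl

  copy-reshuffle : ∀ k π u → copy (reshuffle k π u) ≡ copy u
  copy-reshuffle k π u with copy u ≟ᶠ k
  ... | yes inside = trans (copy-φ k _) (sym inside)
  ... | no  _      = refl

  reshuffle-inverse : ∀ k {π ρ : Fin t → Fin t} → (∀ a → π (ρ a) ≡ a) → ∀ u → reshuffle k π (reshuffle k ρ u) ≡ u
  reshuffle-inverse k {π} {ρ} π∘ρ u with copy u ≟ᶠ k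
  ... | no  outside = reshuffle-outside π outside
  ... | yes refl    = begin
    reshuffle (copy u) π (φ (copy u) (ρ (pos u))) ≡⟨ reshuffle-inside π (copy-φ _ _) ⟩
    φ (copy u) (π (pos (φ (copy u) (ρ (pos u))))) ≡⟨ cong (φ (copy u) ∘ π) (pos-φ _ _) ⟩
    φ (copy u) (π (ρ (pos u)))                    ≡⟨ cong (φ (copy u)) (π∘ρ (pos u)) ⟩
    φ (copy u) (pos u)                            ≡⟨ φ-copy-pos u ⟩
    u                                             ∎
    where open ≡-Reasoning

  reshufflePermutation : ∀ k (σ : Vec (Fin t) t) → isInjective σ ≡ true → Permutation n n
  reshufflePermutation k σ inj = permutation (reshuffle k (σ ⁻¹)) (reshuffle k (lookup σ))
    (reshuffle-inverse k (⁻¹∘lookup σ inj)) (reshuffle-inverse k (lookup∘⁻¹ σ inj))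

  newEdges-reshuffle-≤ : ∀ k σ (inj : isInjective σ ≡ true) → newEdges H (relabel (reshuffle k (σ ⁻¹)) H) ≤ numEdges T
  newEdges-reshuffle-≤ k σ inj = ≤-trans (newEdges-relabel-≤ (reshufflePermutation k σ inj) (λ l → does (l ≟ᶠ k)) fixes S-invariant)
    (≤-reflexive (trans (cong (_* numEdges T) count-k) (*-identityˡ _)))
    where
    fixes : ∀ u → does (copy u ≟ᶠ k) ≡ false → reshuffle k (σ ⁻¹) u ≡ u
    fixes u outside = reshuffle-outside (σ ⁻¹) (λ inside → case trans (sym outside) (dec-true (copy u ≟ᶠ k) inside) of λ ())
    S-invariant : ∀ u → does (copy (reshuffle k (σ ⁻¹) u) ≟ᶠ k) ≡ does (copy u ≟ᶠ k)
    S-invariant u = cong (λ l → does (l ≟ᶠ k)) (copy-reshuffle k (σ ⁻¹) u)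
    count-k : count (λ l → does (l ≟ᶠ k)) ≡ 1
    count-k = trans (∑-allFin-single _ k (λ l l≢k → cong b2n (dec-false (l ≟ᶠ k) l≢k))) (cong b2n (dec-true (k ≟ᶠ k) refl))

  withinCopyFamily : List (Graph n)
  withinCopyFamily = concatMap (λ k → select isInjective (λ σ → relabel (reshuffle k (σ ⁻¹)) H) (endomaps t)) (allFin m)

  multiplicity-withinCopy : ∀ u w → multiplicity withinCopyFamily u w ≡
    ∑[ k ∈ allFin m ] ∑[ σ ∈ endomaps t ] b2n (isInjective σ ∧ adj H (reshuffle k (σ ⁻¹) u) (reshuffle k (σ ⁻¹) w))
  multiplicity-withinCopy u w = trans (multiplicity-concatMap _ (allFin m) u w)
    (∑-cong (allFin m) (λ k → multiplicity-select isInjective _ (endomaps t) u w))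

  withinCopy-across : ∀ {u w} → copy u ≢ copy w → multiplicity withinCopyFamily u w ≡ 0
  withinCopy-across {u} {w} apart = trans (multiplicity-withinCopy u w)
    (trans (∑-cong (allFin m) (λ k → trans (∑-cong (endomaps t) (λ σ → cong b2n (trans
      (cong (isInjective σ ∧_) (adj-across (λ same → apart
        (trans (sym (copy-reshuffle k (σ ⁻¹) u)) (trans same (copy-reshuffle k (σ ⁻¹) w))))))
      (∧-zeroʳ _)))) (∑-zero (endomaps t)))) (∑-zero (allFin m)))

  withinCopy-within : ∀ {u w} → copy u ≡ copy w → multiplicity withinCopyFamily u w ≡
    ∑[ k ∈ allFin m ] (if does (k ≟ᶠ copy u) then symCount (adj T) (pos u) (pos w)
                                              else ∑[ σ ∈ endomaps t ] b2n (isInjective σ ∧ adj H u w))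
  withinCopy-within {u} {w} same = trans (multiplicity-withinCopy u w) (∑-cong (allFin m) term)
    where
    term : ∀ k → ∑[ σ ∈ endomaps t ] b2n (isInjective σ ∧ adj H (reshuffle k (σ ⁻¹) u) (reshuffle k (σ ⁻¹) w))
               ≡ (if does (k ≟ᶠ copy u) then symCount (adj T) (pos u) (pos w)
                                         else ∑[ σ ∈ endomaps t ] b2n (isInjective σ ∧ adj H u w))
    term k with k ≟ᶠ copy u
    ... | yes refl = ∑-cong (endomaps t) (λ σ → cong (λ b → b2n (isInjective σ ∧ b))
          (trans (cong₂ (adj H) (reshuffle-inside (σ ⁻¹) refl) (reshuffle-inside (σ ⁻¹) (sym same))) (φ-adj _ _ _)))
    ... | no  k≢u  = ∑-cong (endomaps t) (λ σ → cong (λ b → b2n (isInjective σ ∧ b))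
          (cong₂ (adj H) (reshuffle-outside (σ ⁻¹) (k≢u ∘ sym)) (reshuffle-outside (σ ⁻¹) (k≢u ∘ sym ∘ trans same))))

  #permutations : ℕ
  #permutations = ∑[ σ ∈ endomaps t ] b2n (isInjective σ)

  withinCopy-edge : ∀ {u w} → adj H u w ≡ true → multiplicity withinCopyFamily u w ≡
    ∑[ k ∈ allFin m ] (if does (k ≟ᶠ copy u) then symCount (adj T) (pos u) (pos w) else #permutations)
  withinCopy-edge {u} {w} Huw = trans (withinCopy-within (adj⇒same-copy Huw)) (∑-cong (allFin m) λ k →
    cong (if does (k ≟ᶠ copy u) then symCount (adj T) (pos u) (pos w) else_)
      (∑-cong (endomaps t) (λ σ → cong (λ b → b2n (isInjective σ ∧ b)) Huw ⟨ trans ⟩ cong b2n (∧-identityʳ _))))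

  withinCopy-nonedge : ∀ {u w} → copy u ≡ copy w → adj H u w ≡ false →
    multiplicity withinCopyFamily u w ≡ symCount (adj T) (pos u) (pos w)
  withinCopy-nonedge {u} {w} same ¬Huw = trans (withinCopy-within same) (trans
    (∑-allFin-single _ (copy u) (λ k k≢u → trans (cong (if_then symCount (adj T) (pos u) (pos w) else _) (dec-false (k ≟ᶠ copy u) k≢u))
      (trans (∑-cong (endomaps t) (λ σ → cong (λ b → b2n (isInjective σ ∧ b)) ¬Huw ⟨ trans ⟩ cong b2n (∧-zeroʳ _)))
             (∑-zero (endomaps t)))))
    (cong (if_then symCount (adj T) (pos u) (pos w) else _) (dec-true (copy u ≟ᶠ copy u) refl)))

  data Choice (ρ : Vec (Fin m) t) (k : Fin m) : Set where
    chosen   : ∀ a → lookup ρ a ≡ k → Choice ρ k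
    unchosen : (∀ a → lookup ρ a ≢ k) → Choice ρ k

  choice : ∀ ρ k → Choice ρ k
  choice ρ k with any? (λ a → lookup ρ a ≟ᶠ k)
  ... | yes (a , ρa≡k) = chosen a ρa≡k
  ... | no  none       = unchosen (λ a ρa≡k → none (a , ρa≡k))

  isChosen : Vec (Fin m) t → Fin m → Bool
  isChosen ρ k = does (any? (λ a → lookup ρ a ≟ᶠ k))

  isChosen-chosen : ∀ ρ {k} a → lookup ρ a ≡ k → isChosen ρ k ≡ true
  isChosen-chosen ρ a ρa≡k = dec-true (any? _) (a , ρa≡k)

  isChosen-unchosen : ∀ ρ {k} → (∀ a → lookup ρ a ≢ k) → isChosen ρ k ≡ false
  isChosen-unchosen ρ none = dec-false (any? _) (λ (a , ρa≡k) → none a ρa≡k)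

  count-isChosen-≤ : ∀ ρ → count (isChosen ρ) ≤ t
  count-isChosen-≤ ρ = begin
    ∑[ k ∈ allFin m ] b2n (isChosen ρ k)
      ≤⟨ ∑-mono-≤ (allFin m) (λ k → hits k (choice ρ k)) ⟩
    ∑[ k ∈ allFin m ] ∑[ a ∈ allFin t ] b2n (does (lookup ρ a ≟ᶠ k))
      ≡⟨ ∑-comm (allFin m) (allFin t) _ ⟩
    ∑[ a ∈ allFin t ] ∑[ k ∈ allFin m ] b2n (does (lookup ρ a ≟ᶠ k))
      ≡⟨ ∑-cong (allFin t) (λ a → ∑-allFin-single _ (lookup ρ a)
          (λ k k≢ρa → cong b2n (dec-false (lookup ρ a ≟ᶠ k) (k≢ρa ∘ sym)))) ⟩
    ∑[ a ∈ allFin t ] b2n (does (lookup ρ a ≟ᶠ lookup ρ a))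
      ≡⟨ ∑-cong (allFin t) (λ a → cong b2n (dec-true (lookup ρ a ≟ᶠ lookup ρ a) refl)) ⟩
    ∑[ a ∈ allFin t ] 1
      ≡⟨ ∑-allFin-one t ⟩
    t ∎
    where
    open ≤-Reasoning
    hits : ∀ k → Choice ρ k → b2n (isChosen ρ k) ≤ ∑[ a ∈ allFin t ] b2n (does (lookup ρ a ≟ᶠ k))
    hits k (chosen a ρa≡k) rewrite isChosen-chosen ρ a ρa≡k =
      subst (_≤ _) (cong b2n (dec-true (lookup ρ a ≟ᶠ k) ρa≡k)) (∈⇒≤∑ (λ b → b2n (does (lookup ρ b ≟ᶠ k))) (∈-allFin a))
    hits k (unchosen none) rewrite isChosen-unchosen ρ none = z≤n

  -- The a-th chosen copy is spread over all chosen copies, landing at position a of each.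
  transversal : Vec (Fin m) t → Vec (Vec (Fin t) t) t → Fin n → Fin n
  transversal ρ σ u with choice ρ (copy u)
  ... | chosen a _ = φ (lookup ρ ((lookup σ a ⁻¹) (pos u))) a
  ... | unchosen _ = u

  transversal⁻¹ : Vec (Fin m) t → Vec (Vec (Fin t) t) t → Fin n → Fin n
  transversal⁻¹ ρ σ u with choice ρ (copy u)
  ... | chosen i _ = φ (lookup ρ (pos u)) (lookup (lookup σ (pos u)) i)
  ... | unchosen _ = u

  module _ {ρ : Vec (Fin m) t} (ρ-injective : isInjective ρ ≡ true) (σ : Vec (Vec (Fin t) t) t) where

    transversal-chosen : ∀ {u} a → lookup ρ a ≡ copy u → transversal ρ σ u ≡ φ (lookup ρ ((lookup σ a ⁻¹) (pos u))) a
    transversal-chosen {u} a ρa≡u with choice ρ (copy u)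
    ... | unchosen none = ⊥-elim (none a ρa≡u)
    ... | chosen a′ ρa′≡u with isInjective⇒injective ρ ρ-injective (trans ρa′≡u (sym ρa≡u))
    ... | refl = refl

    transversal⁻¹-chosen : ∀ {u} i → lookup ρ i ≡ copy u →
      transversal⁻¹ ρ σ u ≡ φ (lookup ρ (pos u)) (lookup (lookup σ (pos u)) i)
    transversal⁻¹-chosen {u} i ρi≡u with choice ρ (copy u)
    ... | unchosen none = ⊥-elim (none i ρi≡u)
    ... | chosen i′ ρi′≡u with isInjective⇒injective ρ ρ-injective (trans ρi′≡u (sym ρi≡u))
    ... | refl = refl

    copy-transversal : ∀ {u} a → lookup ρ a ≡ copy u → copy (transversal ρ σ u) ≡ lookup ρ ((lookup σ a ⁻¹) (pos u))
    copy-transversal a ρa≡u = trans (cong copy (transversal-chosen a ρa≡u)) (copy-φ _ _)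

  transversal-unchosen : ∀ {ρ} σ {u} → (∀ a → lookup ρ a ≢ copy u) → transversal ρ σ u ≡ u
  transversal-unchosen {ρ} σ {u} none with choice ρ (copy u)
  ... | chosen a ρa≡u = ⊥-elim (none a ρa≡u)
  ... | unchosen _    = refl

  transversal⁻¹-unchosen : ∀ {ρ} σ {u} → (∀ a → lookup ρ a ≢ copy u) → transversal⁻¹ ρ σ u ≡ u
  transversal⁻¹-unchosen {ρ} σ {u} none with choice ρ (copy u)
  ... | chosen a ρa≡u = ⊥-elim (none a ρa≡u)
  ... | unchosen _    = refl

  valid : Vec (Fin m) t → Vec (Vec (Fin t) t) t → Bool
  valid ρ σ = isInjective ρ ∧ allInjective σ

  valid⇒ρ-injective : ∀ ρ σ → valid ρ σ ≡ true → isInjective ρ ≡ true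
  valid⇒ρ-injective ρ σ = ∧-true⁻ˡ

  valid⇒σ-injective : ∀ ρ σ → valid ρ σ ≡ true → ∀ a → isInjective (lookup σ a) ≡ true
  valid⇒σ-injective ρ σ ρσ-valid = allInjective-lookup σ (∧-true⁻ʳ {isInjective ρ} ρσ-valid)

  module _ {ρ σ} (ρσ-valid : valid ρ σ ≡ true) where

    private
      ρ-injective = valid⇒ρ-injective ρ σ ρσ-valid
      σ-injective = valid⇒σ-injective ρ σ ρσ-valid

    transversal∘transversal⁻¹ : ∀ u → transversal ρ σ (transversal⁻¹ ρ σ u) ≡ u
    transversal∘transversal⁻¹ u = by (choice ρ (copy u))
      where
      open ≡-Reasoning
      p = pos u
      by : Choice ρ (copy u) → transversal ρ σ (transversal⁻¹ ρ σ u) ≡ u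
      by (unchosen none) = trans (cong (transversal ρ σ) (transversal⁻¹-unchosen σ none)) (transversal-unchosen σ none)
      by (chosen i ρi≡u) = begin
        transversal ρ σ (transversal⁻¹ ρ σ u)
          ≡⟨ cong (transversal ρ σ) (transversal⁻¹-chosen ρ-injective σ i ρi≡u) ⟩
        transversal ρ σ (φ (lookup ρ p) (lookup (lookup σ p) i))
          ≡⟨ transversal-chosen ρ-injective σ p (sym (copy-φ _ _)) ⟩
        φ (lookup ρ ((lookup σ p ⁻¹) (pos (φ (lookup ρ p) (lookup (lookup σ p) i))))) p
          ≡⟨ cong (λ b → φ (lookup ρ ((lookup σ p ⁻¹) b)) p) (pos-φ _ _) ⟩
        φ (lookup ρ ((lookup σ p ⁻¹) (lookup (lookup σ p) i))) p
          ≡⟨ cong (λ j → φ (lookup ρ j) p) (⁻¹∘lookup (lookup σ p) (σ-injective p) i) ⟩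
        φ (lookup ρ i) p
          ≡⟨ cong (λ k → φ k p) ρi≡u ⟩
        φ (copy u) (pos u)
          ≡⟨ φ-copy-pos u ⟩
        u ∎

    transversal⁻¹∘transversal : ∀ u → transversal⁻¹ ρ σ (transversal ρ σ u) ≡ u
    transversal⁻¹∘transversal u = by (choice ρ (copy u))
      where
      open ≡-Reasoning
      by : Choice ρ (copy u) → transversal⁻¹ ρ σ (transversal ρ σ u) ≡ u
      by (unchosen none) = trans (cong (transversal⁻¹ ρ σ) (transversal-unchosen σ none)) (transversal⁻¹-unchosen σ none)
      by (chosen a ρa≡u) = begin
        transversal⁻¹ ρ σ (transversal ρ σ u)
          ≡⟨ cong (transversal⁻¹ ρ σ) (transversal-chosen ρ-injective σ a ρa≡u) ⟩
        transversal⁻¹ ρ σ (φ (lookup ρ i) a)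
          ≡⟨ transversal⁻¹-chosen ρ-injective σ i (sym (copy-φ _ _)) ⟩
        φ (lookup ρ (pos (φ (lookup ρ i) a))) (lookup (lookup σ (pos (φ (lookup ρ i) a))) i)
          ≡⟨ cong (λ b → φ (lookup ρ b) (lookup (lookup σ b) i)) (pos-φ _ _) ⟩
        φ (lookup ρ a) (lookup (lookup σ a) i)
          ≡⟨ cong (φ (lookup ρ a)) (lookup∘⁻¹ (lookup σ a) (σ-injective a) (pos u)) ⟩
        φ (lookup ρ a) (pos u)
          ≡⟨ cong (λ k → φ k (pos u)) ρa≡u ⟩
        φ (copy u) (pos u)
          ≡⟨ φ-copy-pos u ⟩
        u ∎
          where i = (lookup σ a ⁻¹) (pos u)

    transversalPermutation : Permutation n n
    transversalPermutation = permutation (transversal ρ σ) (transversal⁻¹ ρ σ) transversal∘transversal⁻¹ transversal⁻¹∘transversal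

    isChosen-transversal : ∀ u → isChosen ρ (copy (transversal ρ σ u)) ≡ isChosen ρ (copy u)
    isChosen-transversal u = by (choice ρ (copy u))
      where
      by : Choice ρ (copy u) → isChosen ρ (copy (transversal ρ σ u)) ≡ isChosen ρ (copy u)
      by (chosen a ρa≡u) = trans (isChosen-chosen ρ _ (sym (copy-transversal ρ-injective σ a ρa≡u))) (sym (isChosen-chosen ρ a ρa≡u))
      by (unchosen none) = cong (isChosen ρ ∘ copy) (transversal-unchosen σ none)

    newEdges-transversal-≤ : newEdges H (relabel (transversal ρ σ) H) ≤ t * numEdges T
    newEdges-transversal-≤ = ≤-trans
      (newEdges-relabel-≤ transversalPermutation (isChosen ρ) fixes isChosen-transversal)
      (*-monoˡ-≤ (numEdges T) (count-isChosen-≤ ρ))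
      where
      fixes : ∀ u → isChosen ρ (copy u) ≡ false → transversal ρ σ u ≡ u
      fixes u unchosen-u = transversal-unchosen σ (λ a ρa≡u → case trans (sym unchosen-u) (isChosen-chosen ρ a ρa≡u) of λ ())

  choices : List (Vec (Fin m) t)
  choices = vectors (allFin m) t

  shuffles : List (Vec (Vec (Fin t) t) t)
  shuffles = vectors (endomaps t) t

  transversalFamily : List (Graph n)
  transversalFamily = concatMap (λ ρ → select (valid ρ) (λ σ → relabel (transversal ρ σ) H) shuffles) choices

  transversalCount : Fin n → Fin n → ℕ
  transversalCount u w = ∑[ ρ ∈ choices ] ∑[ σ ∈ shuffles ] b2n (valid ρ σ ∧ adj H (transversal ρ σ u) (transversal ρ σ w))

  multiplicity-transversal : ∀ u w → multiplicity transversalFamily u w ≡ transversalCount u w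
  multiplicity-transversal u w = trans (multiplicity-concatMap _ choices u w)
    (∑-cong choices (λ ρ → multiplicity-select (valid ρ) _ shuffles u w))

  transversalCount-sym : ∀ u w → transversalCount u w ≡ transversalCount w u
  transversalCount-sym u w = ∑-cong choices (λ ρ → ∑-cong shuffles (λ σ → cong (λ b → b2n (valid ρ σ ∧ b)) (Graph.sym H _ _)))

  module _ (κ : Permutation m m) where

    recopy : Fin n → Fin n
    recopy u = φ (κ ⟨$⟩ʳ copy u) (pos u)

    adj-recopy : ∀ u w → adj H (recopy u) (recopy w) ≡ adj H u w
    adj-recopy u w with copy u ≟ᶠ copy w
    ... | yes same = begin
      adj H (recopy u) (recopy w)
        ≡⟨ adj-within (trans (copy-φ _ _) (trans (cong (κ ⟨$⟩ʳ_) same) (sym (copy-φ _ _)))) ⟩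
      adj T (pos (recopy u)) (pos (recopy w))
        ≡⟨ cong₂ (adj T) (pos-φ _ _) (pos-φ _ _) ⟩
      adj T (pos u) (pos w)
        ≡⟨ sym (adj-within same) ⟩
      adj H u w ∎
      where open ≡-Reasoning
    ... | no apart = trans
      (adj-across (λ e → apart (permutation-injective κ (trans (sym (copy-φ _ (pos u))) (trans e (copy-φ _ _))))))
      (sym (adj-across apart))

    transversal-recopy : ∀ {ρ} σ → isInjective ρ ≡ true → ∀ u →
      transversal (Vec.map (κ ⟨$⟩ʳ_) ρ) σ (recopy u) ≡ recopy (transversal ρ σ u)
    transversal-recopy {ρ} σ ρ-injective u = by (choice ρ (copy u))
      where
      open ≡-Reasoning
      κρ = Vec.map (κ ⟨$⟩ʳ_) ρ
      by : Choice ρ (copy u) → transversal κρ σ (recopy u) ≡ recopy (transversal ρ σ u)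
      by (chosen a ρa≡u) = begin
        transversal κρ σ (recopy u)
          ≡⟨ transversal-chosen (trans (isInjective-map κ ρ) ρ-injective) σ a κρa≡recopy-u ⟩
        φ (lookup κρ ((lookup σ a ⁻¹) (pos (recopy u)))) a
          ≡⟨ cong (λ b → φ (lookup κρ ((lookup σ a ⁻¹) b)) a) (pos-φ _ _) ⟩
        φ (lookup κρ ((lookup σ a ⁻¹) (pos u))) a
          ≡⟨ cong (λ k → φ k a) (lookup-map _ _ ρ) ⟩
        φ (κ ⟨$⟩ʳ lookup ρ ((lookup σ a ⁻¹) (pos u))) a
          ≡⟨ sym (cong₂ (λ k b → φ (κ ⟨$⟩ʳ k) b) (copy-φ _ _) (pos-φ _ _)) ⟩
        recopy (φ (lookup ρ ((lookup σ a ⁻¹) (pos u))) a)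
          ≡⟨ cong recopy (sym (transversal-chosen ρ-injective σ a ρa≡u)) ⟩
        recopy (transversal ρ σ u) ∎
        where
        κρa≡recopy-u : lookup κρ a ≡ copy (recopy u)
        κρa≡recopy-u = trans (lookup-map a _ ρ) (trans (cong (κ ⟨$⟩ʳ_) ρa≡u) (sym (copy-φ _ _)))
      by (unchosen none) = trans (transversal-unchosen σ none′) (cong recopy (sym (transversal-unchosen σ none)))
        where
        none′ : ∀ a → lookup κρ a ≢ copy (recopy u)
        none′ a e = none a (permutation-injective κ (trans (sym (lookup-map a _ ρ)) (trans e (copy-φ _ _))))

    transversalCount-recopy : ∀ u w → transversalCount (recopy u) (recopy w) ≡ transversalCount u w
    transversalCount-recopy u w = trans (sym (∑-vectors-map (∑-allFin-permute κ) t _)) (∑-cong choices term)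
      where
      term : ∀ ρ → let κρ = Vec.map (κ ⟨$⟩ʳ_) ρ in
        ∑[ σ ∈ shuffles ] b2n (valid κρ σ ∧ adj H (transversal κρ σ (recopy u)) (transversal κρ σ (recopy w)))
          ≡ ∑[ σ ∈ shuffles ] b2n (valid ρ σ ∧ adj H (transversal ρ σ u) (transversal ρ σ w))
      term ρ = ∑-cong shuffles (λ σ → cong b2n (∧-cong-if (cong (_∧ allInjective σ) (isInjective-map κ ρ)) (λ ρσ-valid →
        let ρ-injective = valid⇒ρ-injective ρ σ ρσ-valid in
        trans (cong₂ (adj H) (transversal-recopy σ ρ-injective u) (transversal-recopy σ ρ-injective w))
              (adj-recopy _ _))))

  module _ (k : Fin m) (π : Permutation t t) where

    private
      term : Fin n → Fin n → Vec (Fin m) t → Vec (Vec (Fin t) t) t → ℕ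
      term w x ρ σ = b2n (valid ρ σ ∧ adj H (transversal ρ σ x) (transversal ρ σ w))

    transversalCount-reposition : ∀ b {w} → copy w ≢ k → transversalCount (φ k (π ⟨$⟩ʳ b)) w ≡ transversalCount (φ k b) w
    transversalCount-reposition b {w} w∉k = ∑-cong choices (λ ρ → by ρ (choice ρ k))
      where
      by : ∀ ρ → Choice ρ k → ∑ shuffles (term w (φ k (π ⟨$⟩ʳ b)) ρ) ≡ ∑ shuffles (term w (φ k b) ρ)
      by ρ (chosen a ρa≡k) = trans
        (sym (∑-vectors-updateAt (∑-vectors-map (∑-allFin-permute π) t) a _))
        (∑-cong shuffles (λ σ → cong b2n (∧-cong-if (cong (isInjective ρ ∧_) (allInjective-updateAt π σ a)) (λ ρσ-valid →
          cong₂ (adj H) (moved σ ρσ-valid) (unmoved σ (valid⇒ρ-injective ρ σ ρσ-valid) (choice ρ (copy w)))))))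
        where
        open ≡-Reasoning
        σ′ : Vec (Vec (Fin t) t) t → Vec (Vec (Fin t) t) t
        σ′ σ = Vec.updateAt σ a (Vec.map (π ⟨$⟩ʳ_))
        moved : ∀ σ → valid ρ σ ≡ true → transversal ρ (σ′ σ) (φ k (π ⟨$⟩ʳ b)) ≡ transversal ρ σ (φ k b)
        moved σ ρσ-valid = begin
          transversal ρ (σ′ σ) (φ k (π ⟨$⟩ʳ b))
            ≡⟨ transversal-chosen ρ-injective (σ′ σ) a (trans ρa≡k (sym (copy-φ _ _))) ⟩
          φ (lookup ρ ((lookup (σ′ σ) a ⁻¹) (pos (φ k (π ⟨$⟩ʳ b))))) a
            ≡⟨ cong₂ (λ v p → φ (lookup ρ ((v ⁻¹) p)) a) (lookup∘updateAt a σ) (pos-φ _ _) ⟩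
          φ (lookup ρ ((Vec.map (π ⟨$⟩ʳ_) (lookup σ a) ⁻¹) (π ⟨$⟩ʳ b))) a
            ≡⟨ cong (λ i → φ (lookup ρ i) a) (⁻¹-map (lookup σ a) (valid⇒σ-injective ρ σ ρσ-valid a) π b) ⟩
          φ (lookup ρ ((lookup σ a ⁻¹) b)) a
            ≡⟨ cong (λ p → φ (lookup ρ ((lookup σ a ⁻¹) p)) a) (sym (pos-φ k b)) ⟩
          φ (lookup ρ ((lookup σ a ⁻¹) (pos (φ k b)))) a
            ≡⟨ sym (transversal-chosen ρ-injective σ a (trans ρa≡k (sym (copy-φ _ _)))) ⟩
          transversal ρ σ (φ k b) ∎
          where ρ-injective = valid⇒ρ-injective ρ σ ρσ-valid
        unmoved : ∀ σ → isInjective ρ ≡ true → Choice ρ (copy w) → transversal ρ (σ′ σ) w ≡ transversal ρ σ w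
        unmoved σ ρ-injective (chosen a′ ρa′≡w) = begin
          transversal ρ (σ′ σ) w
            ≡⟨ transversal-chosen ρ-injective (σ′ σ) a′ ρa′≡w ⟩
          φ (lookup ρ ((lookup (σ′ σ) a′ ⁻¹) (pos w))) a′
            ≡⟨ cong (λ v → φ (lookup ρ ((v ⁻¹) (pos w))) a′) (lookup∘updateAt′ a′ a a′≢a σ) ⟩
          φ (lookup ρ ((lookup σ a′ ⁻¹) (pos w))) a′
            ≡⟨ sym (transversal-chosen ρ-injective σ a′ ρa′≡w) ⟩
          transversal ρ σ w ∎
          where
          a′≢a : a′ ≢ a
          a′≢a a′≡a = w∉k (trans (sym ρa′≡w) (trans (cong (lookup ρ) a′≡a) ρa≡k))
        unmoved σ _ (unchosen none) = trans (transversal-unchosen (σ′ σ) none) (sym (transversal-unchosen σ none))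
      by ρ (unchosen k-unchosen) = ∑-cong shuffles (λ σ → trans (no-edge σ (π ⟨$⟩ʳ b)) (sym (no-edge σ b)))
        where
        fixed : ∀ σ x → transversal ρ σ (φ k x) ≡ φ k x
        fixed σ x = transversal-unchosen σ (λ a ρa≡ → k-unchosen a (trans ρa≡ (copy-φ k x)))
        apart : ∀ σ → isInjective ρ ≡ true → Choice ρ (copy w) → copy (transversal ρ σ w) ≢ k
        apart σ ρ-injective (chosen a′ ρa′≡w) e = k-unchosen _ (trans (sym (copy-transversal ρ-injective σ a′ ρa′≡w)) e)
        apart σ _           (unchosen none)    e = w∉k (trans (sym (cong copy (transversal-unchosen σ none))) e)
        no-edge : ∀ σ x → term w (φ k x) ρ σ ≡ 0
        no-edge σ x = cong b2n (trans (∧-cong-if refl (λ ρσ-valid →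
          adj-across (λ e → apart σ (valid⇒ρ-injective ρ σ ρσ-valid) (choice ρ (copy w))
            (trans (sym e) (trans (cong copy (fixed σ x)) (copy-φ k x)))))) (∧-zeroʳ _))

  pos-≢ : ∀ {u w} → copy u ≡ copy w → u ≢ w → pos u ≢ pos w
  pos-≢ {u} {w} same u≢w same-pos = u≢w (trans (sym (φ-copy-pos u)) (trans (cong₂ φ same same-pos) (φ-copy-pos w)))

  adj-transversal-within : ∀ {ρ σ} → valid ρ σ ≡ true → ∀ {u w} → copy u ≡ copy w → u ≢ w →
    adj H (transversal ρ σ u) (transversal ρ σ w) ≡ not (isChosen ρ (copy u)) ∧ adj H u w
  adj-transversal-within {ρ} {σ} ρσ-valid {u} {w} same u≢w = by (choice ρ (copy u))
    where
    ρ-injective = valid⇒ρ-injective ρ σ ρσ-valid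
    by : Choice ρ (copy u) → adj H (transversal ρ σ u) (transversal ρ σ w) ≡ not (isChosen ρ (copy u)) ∧ adj H u w
    by (chosen a ρa≡u) rewrite isChosen-chosen ρ a ρa≡u = adj-across λ e →
      pos-≢ same u≢w (permutation-injective (⁻¹-permutation (lookup σ a) (valid⇒σ-injective ρ σ ρσ-valid a))
        (isInjective⇒injective ρ ρ-injective (trans (sym (copy-transversal ρ-injective σ a ρa≡u))
          (trans e (copy-transversal ρ-injective σ a (trans ρa≡u same))))))
    by (unchosen none) rewrite isChosen-unchosen ρ none =
      cong₂ (adj H) (transversal-unchosen σ none) (transversal-unchosen σ (λ a ρa≡w → none a (trans ρa≡w (sym same))))

  unchosenCount : Fin m → ℕ
  unchosenCount k = ∑[ ρ ∈ choices ] ∑[ σ ∈ shuffles ] b2n (valid ρ σ ∧ not (isChosen ρ k))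

  private
    transversalCount-within : ∀ {u w} → copy u ≡ copy w → u ≢ w →
      transversalCount u w ≡ ∑[ ρ ∈ choices ] ∑[ σ ∈ shuffles ] b2n (valid ρ σ ∧ (not (isChosen ρ (copy u)) ∧ adj H u w))
    transversalCount-within same u≢w = ∑-cong choices (λ ρ → ∑-cong shuffles (λ σ → cong b2n (∧-cong-if refl (λ ρσ-valid →
      adj-transversal-within ρσ-valid same u≢w))))

  transversalCount-edge : ∀ {u w} → adj H u w ≡ true → transversalCount u w ≡ unchosenCount (copy u)
  transversalCount-edge {u} {w} Huw = trans (transversalCount-within (adj⇒same-copy Huw) (edge-≢ H Huw))
    (∑-cong choices (λ ρ → ∑-cong shuffles (λ σ → cong (λ b → b2n (valid ρ σ ∧ b))
      (trans (cong (not (isChosen ρ (copy u)) ∧_) Huw) (∧-identityʳ _)))))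

  transversalCount-within-nonedge : ∀ {u w} → copy u ≡ copy w → u ≢ w → adj H u w ≡ false → transversalCount u w ≡ 0
  transversalCount-within-nonedge {u} {w} same u≢w ¬Huw = trans (transversalCount-within same u≢w)
    (trans (∑-cong choices (λ ρ → trans (∑-cong shuffles (λ σ → cong b2n
      (trans (cong (λ b → valid ρ σ ∧ (not (isChosen ρ (copy u)) ∧ b)) ¬Huw)
             (trans (cong (valid ρ σ ∧_) (∧-zeroʳ _)) (∧-zeroʳ _))))) (∑-zero shuffles))) (∑-zero choices))

  isChosen-map : ∀ (κ : Permutation m m) ρ k → isChosen (Vec.map (κ ⟨$⟩ʳ_) ρ) (κ ⟨$⟩ʳ k) ≡ isChosen ρ k
  isChosen-map κ ρ k = does-⇔ (mk⇔ forget remember) (any? _) (any? _)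
    where
    forget : (∃ λ a → lookup (Vec.map (κ ⟨$⟩ʳ_) ρ) a ≡ κ ⟨$⟩ʳ k) → ∃ λ a → lookup ρ a ≡ k
    forget (a , e) = a , permutation-injective κ (trans (sym (lookup-map a _ ρ)) e)
    remember : (∃ λ a → lookup ρ a ≡ k) → ∃ λ a → lookup (Vec.map (κ ⟨$⟩ʳ_) ρ) a ≡ κ ⟨$⟩ʳ k
    remember (a , e) = a , trans (lookup-map a _ ρ) (cong (κ ⟨$⟩ʳ_) e)

  unchosenCount-const : ∀ k k′ → unchosenCount k ≡ unchosenCount k′
  unchosenCount-const k k′ = trans (∑-cong choices term) (∑-vectors-map (∑-allFin-permute κ) t _)
    where
    κ = transpose k k′
    term : ∀ ρ → ∑[ σ ∈ shuffles ] b2n (valid ρ σ ∧ not (isChosen ρ k))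
               ≡ ∑[ σ ∈ shuffles ] b2n (valid (Vec.map (κ ⟨$⟩ʳ_) ρ) σ ∧ not (isChosen (Vec.map (κ ⟨$⟩ʳ_) ρ) k′))
    term ρ = ∑-cong shuffles (λ σ → cong₂ (λ b c → b2n ((b ∧ allInjective σ) ∧ not c)) (sym (isInjective-map κ ρ))
      (sym (trans (cong (isChosen (Vec.map (κ ⟨$⟩ʳ_) ρ)) (sym (transpose-matchˡ k k′))) (isChosen-map κ ρ k))))

  module _ (t≤m : t ≤ m) {a₀ b₀ : Fin t} (T-edge : adj T a₀ b₀ ≡ true) where

    private
      ρ₀ : Vec (Fin m) t
      ρ₀ = Vec.tabulate (λ a → inject≤ a t≤m)

      ρ₀-injective : isInjective ρ₀ ≡ true
      ρ₀-injective = dec-true (injective? ρ₀) (λ {a} {b} e → inject≤-injective t≤m t≤m a b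
        (trans (sym (lookup∘tabulate _ a)) (trans e (lookup∘tabulate _ b))))

      σ₀ : Vec (Vec (Fin t) t) t
      σ₀ = Vec.replicate t (Vec.allFin t)

      σ₀⁻¹ : ∀ a x → (lookup σ₀ a ⁻¹) x ≡ x
      σ₀⁻¹ a x rewrite lookup-replicate a (Vec.allFin t) = allFin⁻¹ x

      ρ₀σ₀-valid : valid ρ₀ σ₀ ≡ true
      ρ₀σ₀-valid rewrite ρ₀-injective = allInjective-replicate t (isInjective-allFin {t})

      k₀ l₀ : Fin m
      k₀ = lookup ρ₀ a₀
      l₀ = lookup ρ₀ b₀

      k₀≢l₀ : k₀ ≢ l₀
      k₀≢l₀ = edge-≢ T T-edge ∘ isInjective⇒injective ρ₀ ρ₀-injective

    crossCount : ℕ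
    crossCount = transversalCount (φ k₀ a₀) (φ l₀ a₀)

    -- With the identity shuffles, φ k₀ a₀ stays put while φ l₀ a₀ moves to φ k₀ b₀.
    crossCount-positive : 1 ≤ crossCount
    crossCount-positive = begin
      1
        ≡⟨ cong b2n (sym (trans (cong₂ _∧_ ρ₀σ₀-valid image-edge) T-edge)) ⟩
      b2n (valid ρ₀ σ₀ ∧ adj H (transversal ρ₀ σ₀ (φ k₀ a₀)) (transversal ρ₀ σ₀ (φ l₀ a₀)))
        ≤⟨ ∈⇒≤∑ _ (∈-vectors σ₀ (λ a → ∈-endomaps (lookup σ₀ a))) ⟩
      ∑[ σ ∈ shuffles ] b2n (valid ρ₀ σ ∧ adj H (transversal ρ₀ σ (φ k₀ a₀)) (transversal ρ₀ σ (φ l₀ a₀)))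
        ≤⟨ ∈⇒≤∑ (λ ρ → ∑[ σ ∈ shuffles ] b2n (valid ρ σ ∧ adj H (transversal ρ σ (φ k₀ a₀)) (transversal ρ σ (φ l₀ a₀))))
            (∈-vectors ρ₀ (λ a → ∈-allFin (lookup ρ₀ a))) ⟩
      crossCount ∎
      where
      open ≤-Reasoning
      image : ∀ {a b} → transversal ρ₀ σ₀ (φ (lookup ρ₀ a) b) ≡ φ (lookup ρ₀ b) a
      image {a} {b} = trans (transversal-chosen ρ₀-injective σ₀ a (sym (copy-φ _ _)))
        (cong (λ p → φ (lookup ρ₀ p) a) (trans (cong (lookup σ₀ a ⁻¹) (pos-φ _ _)) (σ₀⁻¹ a b)))
      image-edge : adj H (transversal ρ₀ σ₀ (φ k₀ a₀)) (transversal ρ₀ σ₀ (φ l₀ a₀)) ≡ adj T a₀ b₀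
      image-edge = trans (cong₂ (adj H) image image) (φ-adj _ _ _)

    transversalCount-across : ∀ {u w} → copy u ≢ copy w → transversalCount u w ≡ crossCount
    transversalCount-across {u} {w} apart with permutation-sending apart k₀≢l₀
    ... | κ , κu≡k₀ , κw≡l₀ = begin
      transversalCount u w
        ≡⟨ sym (transversalCount-recopy κ u w) ⟩
      transversalCount (recopy κ u) (recopy κ w)
        ≡⟨ cong₂ (λ k l → transversalCount (φ k (pos u)) (φ l (pos w))) κu≡k₀ κw≡l₀ ⟩
      transversalCount (φ k₀ (pos u)) (φ l₀ (pos w))
        ≡⟨ sym (move-to-a₀ k₀≢l₀ (pos u)) ⟩
      transversalCount (φ k₀ a₀) (φ l₀ (pos w))
        ≡⟨ transversalCount-sym _ _ ⟩
      transversalCount (φ l₀ (pos w)) (φ k₀ a₀)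
        ≡⟨ sym (move-to-a₀ (k₀≢l₀ ∘ sym) (pos w)) ⟩
      transversalCount (φ l₀ a₀) (φ k₀ a₀)
        ≡⟨ transversalCount-sym _ _ ⟩
      crossCount ∎
      where
      open ≡-Reasoning
      move-to-a₀ : ∀ {k l} → k ≢ l → ∀ b {c} → transversalCount (φ k a₀) (φ l c) ≡ transversalCount (φ k b) (φ l c)
      move-to-a₀ {k} {l} k≢l b {c} = trans
        (cong (λ a → transversalCount (φ k a) (φ l c)) (sym (transpose-matchˡ b a₀)))
        (transversalCount-reposition k (transpose b a₀) b (λ e → k≢l (trans (sym e) (copy-φ l c))))

  module _ {q} (T-edges : numEdges T ≡ q) {a₀ b₀ : Fin t} (T-edge : adj T a₀ b₀ ≡ true) where

    private
      Cover : List (Graph n) → Set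
      Cover = UniformCoverKn H (q * t)

    cover-by-relabellings : m ≤ t → Fin m → Cover (relabellings H)
    cover-by-relabellings m≤t k = AllL-select isInjective _ (endomaps n) member , (c , edge) , (c , positive , nonedge)
      where
      c = symCount (adj H) (φ k a₀) (φ k b₀)
      φka₀≢φkb₀ : φ k a₀ ≢ φ k b₀
      φka₀≢φkb₀ e = edge-≢ T T-edge (proj₂ (φ-injective _ _ _ _ e))
      constant : ∀ {u w} → u ≢ w → multiplicity (relabellings H) u w ≡ c
      constant u≢w = trans (multiplicity-relabellings H _ _) (symCount-const (adj H) u≢w φka₀≢φkb₀)
      edge : ∀ u w → adj H u w ≡ true → multiplicity (relabellings H) u w ≡ c
      edge u w Huw = constant (edge-≢ H Huw)
      nonedge : ∀ u w → K n u w ≡ true → adj H u w ≡ false → multiplicity (relabellings H) u w ≡ c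
      nonedge u w Kuw _ = constant (K-≢ Kuw)
      positive : 1 ≤ c
      positive = subst (λ b → b2n b ≤ c) (trans (φ-adj k a₀ b₀) T-edge) (symCount-≥ (adj H) _ _)
      member : ∀ v → isInjective v ≡ true → (relabel (v ⁻¹) H ≅ H) × (newEdges H (relabel (v ⁻¹) H) ≤ q * t)
      member v inj = relabel-≅ (⁻¹-permutation v inj) H , (begin
        newEdges H (relabel (v ⁻¹) H)
          ≤⟨ newEdges-relabel-≤ (⁻¹-permutation v inj) (λ _ → true) (λ _ ()) (λ _ → refl) ⟩
        count (λ _ → true) * numEdges T
          ≡⟨ cong₂ _*_ (∑-allFin-one m) T-edges ⟩
        m * q
          ≤⟨ *-monoˡ-≤ q m≤t ⟩
        t * q
          ≡⟨ *-comm t q ⟩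
        q * t ∎)
        where open ≤-Reasoning

    cover-by-transversals : (t≤m : t ≤ m) →
      Cover (repeat (crossCount t≤m T-edge) withinCopyFamily ++ repeat (symCount (adj T) a₀ b₀) transversalFamily)
    cover-by-transversals t≤m = AllL-++ (AllL-repeat X within-members) (AllL-repeat M transversal-members)
                              , (X * C + M * unchosenCount k₀ , edge)
                              , (X * M , *-mono-≤ (crossCount-positive t≤m T-edge) M-positive , nonedge)
      where
      open ≡-Reasoning
      X = crossCount t≤m T-edge
      M = symCount (adj T) a₀ b₀
      k₀ : Fin m
      k₀ = inject≤ a₀ t≤m
      C = ∑[ k ∈ allFin m ] (if does (k ≟ᶠ k₀) then M else #permutations)

      a₀≢b₀ : a₀ ≢ b₀
      a₀≢b₀ = edge-≢ T T-edge

      M-positive : 1 ≤ M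
      M-positive = subst (λ b → b2n b ≤ M) T-edge (symCount-≥ (adj T) a₀ b₀)

      multiplicity-split : ∀ u w → multiplicity (repeat X withinCopyFamily ++ repeat M transversalFamily) u w
                                 ≡ X * multiplicity withinCopyFamily u w + M * transversalCount u w
      multiplicity-split u w = trans (multiplicity-++ (repeat X withinCopyFamily) _ u w) (cong₂ _+_
        (multiplicity-repeat X withinCopyFamily u w)
        (trans (multiplicity-repeat M transversalFamily u w) (cong (M *_) (multiplicity-transversal u w))))

      edge : ∀ u w → adj H u w ≡ true → _ ≡ X * C + M * unchosenCount k₀
      edge u w Huw = begin
        _
          ≡⟨ multiplicity-split u w ⟩
        X * multiplicity withinCopyFamily u w + M * transversalCount u w
          ≡⟨ cong₂ (λ a b → X * a + M * b) (withinCopy-edge Huw) (transversalCount-edge Huw) ⟩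
        X * ∑[ k ∈ allFin m ] (if does (k ≟ᶠ copy u) then symCount (adj T) (pos u) (pos w) else #permutations) + M * unchosenCount (copy u)
          ≡⟨ cong₂ (λ a b → X * a + M * b) within-value (unchosenCount-const (copy u) k₀) ⟩
        X * C + M * unchosenCount k₀ ∎
        where
        same = adj⇒same-copy Huw
        within-value : ∑[ k ∈ allFin m ] (if does (k ≟ᶠ copy u) then symCount (adj T) (pos u) (pos w) else #permutations) ≡ C
        within-value = trans
          (cong (λ s → ∑[ k ∈ allFin m ] (if does (k ≟ᶠ copy u) then s else #permutations))
            (symCount-const (adj T) (pos-≢ same (edge-≢ H Huw)) a₀≢b₀))
          (∑-allFin-if≟ (copy u) k₀ M #permutations)

      nonedge : ∀ u w → K n u w ≡ true → adj H u w ≡ false → _ ≡ X * M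
      nonedge u w Kuw ¬Huw with copy u ≟ᶠ copy w
      ... | yes same = begin
        _
          ≡⟨ multiplicity-split u w ⟩
        X * multiplicity withinCopyFamily u w + M * transversalCount u w
          ≡⟨ cong₂ (λ a b → X * a + M * b)
              (withinCopy-nonedge same ¬Huw) (transversalCount-within-nonedge same (K-≢ Kuw) ¬Huw) ⟩
        X * symCount (adj T) (pos u) (pos w) + M * 0
          ≡⟨ cong₂ (λ a b → X * a + b) (symCount-const (adj T) (pos-≢ same (K-≢ Kuw)) a₀≢b₀) (*-zeroʳ M) ⟩
        X * M + 0
          ≡⟨ +-identityʳ _ ⟩
        X * M ∎
      ... | no apart = begin
        _
          ≡⟨ multiplicity-split u w ⟩
        X * multiplicity withinCopyFamily u w + M * transversalCount u w
          ≡⟨ cong₂ (λ a b → X * a + M * b) (withinCopy-across apart) (transversalCount-across t≤m T-edge apart) ⟩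
        X * 0 + M * X
          ≡⟨ cong (_+ M * X) (*-zeroʳ X) ⟩
        M * X
          ≡⟨ *-comm M X ⟩
        X * M ∎

      within-members : AllL (λ H′ → (H′ ≅ H) × (newEdges H H′ ≤ q * t)) withinCopyFamily
      within-members = AllL-concatMap _ (allFin m) λ k → AllL-select isInjective _ (endomaps t) λ σ inj →
        relabel-≅ (reshufflePermutation k σ inj) H ,
        ≤-trans (newEdges-reshuffle-≤ k σ inj) (≤-trans (≤-reflexive T-edges) (m≤m*n q t {{nonZeroIndex a₀}}))

      transversal-members : AllL (λ H′ → (H′ ≅ H) × (newEdges H H′ ≤ q * t)) transversalFamily
      transversal-members = AllL-concatMap _ choices λ ρ → AllL-select (valid ρ) _ shuffles λ σ ρσ-valid →
        relabel-≅ (transversalPermutation ρσ-valid) H ,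
        ≤-trans (newEdges-transversal-≤ ρσ-valid) (≤-reflexive (trans (cong (t *_) T-edges) (*-comm t q)))

lemma2p6 : ∀ {t q n} (T : Graph t) → numEdges T ≡ q → 1 ≤ q → t ∣ n →
    (H : Graph n) → IsFactor T H →
    ∃ λ (𝓗 : List (Graph n)) → UniformCoverKn H (q * t) 𝓗
lemma2p6 T T-edges q≥1 _ H (zero , refl , _) = [] , [] , (0 , λ ()) , (1 , ≤-refl , λ ())
lemma2p6 {t} T T-edges q≥1 _ H (suc m , refl , φ , φ-injective , φ-adj , φ-cover)
  with (a₀ , b₀) , T-edge ← positive-count⇒witness (pairs t) (λ (a , b) → adj T a b) (subst (1 ≤_) (sym T-edges) q≥1)
  with suc m ≤? t
... | yes m≤t = relabellings H , cover-by-relabellings T-edges T-edge m≤t zero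
  where open Factor T H φ φ-injective φ-adj φ-cover
... | no  m≰t = _ , cover-by-transversals T-edges T-edge (<⇒≤ (≰⇒> m≰t))
  where open Factor T H φ φ-injective φ-adj φ-cover
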